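{- For $n\ge1$ and $k\in[1,n]$, $$\chi_k^{(n)}=\sum_{(i_1,\dots,i_k)\in\mathcal{Q}(n,k)}\mathrm{C}_{i_1}\cdots\mathrm{C}_{i_k},\qquad \mathcal{Q}(n,k)=\{(i_1,\dots,i_k)\in[0,n-1]^k : i_1+\cdots+i_k=n-k\}.$$
   Context: $\mathrm{C}_m=\frac{1}{m+1}\binom{2m}{m}$ is the $m$-th Catalan number ($\mathrm{C}_0=1$). TL-diagrams on $n$ points: non-crossing perfect matchings of top points $1,\dots,n$ and bottom points $1',\dots,n'$ drawn as $n$ disjoint arcs in the strip $\mathbb{R}\times[0,1]$, up to isotopy; the left side is the unbounded complementary region containing points $(x,1/2)$ with $x$ very negative; an arc is exposed to the left side if it lies on the boundary of that region. $\chi_k^{(n)}$ is the number of TL-diagrams on $n$ points with exactly $k$ arcs exposed to the left side. -}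

module Defs where

open import Data.Nat using (ℕ; zero; suc; _+_; _*_; _∸_; _/_; _<ᵇ_; _≡ᵇ_)
open import Data.Nat.Combinatorics using (_C_)
open import Data.Fin using (Fin; toℕ)
open import Data.Fin.Properties using (_≟_)
open import Data.Bool using (Bool; true; false; _∧_; _∨_; not; if_then_else_)
open import Data.List using (List; []; _∷_; map; concatMap; allFin)
open import Data.Nat.ListAction using (sum; product)
open import Data.Bool.ListAction using (all; any)
open import Data.Vec using (Vec; []; _∷_; lookup; toList)
open import Relation.Nullary.Decidable using (⌊_⌋)

catalan : ℕ → ℕ
catalan m = ((m + m) C m) / suc m

allVecs : (m k : ℕ) → List (Vec (Fin m) k)
allVecs m zero    = [] ∷ []
allVecs m (suc k) = concatMap (λ i → map (i ∷_) (allVecs m k)) (allFin m)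

-- The 2n boundary points are labelled by Fin (n + n), in the order in which
-- they are met going once around the boundary of the strip starting just
-- after the left side: position i (i < n) is the top point i+1, and position
-- n + j (j < n) is the bottom point (n-j)'.  So positions 0 .. 2n-1 read
-- 1, 2, …, n, n', …, 2', 1'.  A perfect matching is a fixed-point-free
-- involution f of the positions; it can be drawn by disjoint arcs in the
-- strip iff it is non-crossing with respect to this cyclic order.
-- A diagram is given by the vector of values (f 0, …, f (2n-1)).

countTrue : ∀ {A : Set} → (A → Bool) → List A → ℕ
countTrue p []       = 0
countTrue p (x ∷ xs) = if p x then suc (countTrue p xs) else countTrue p xs

boolFilter : ∀ {A : Set} → (A → Bool) → List A → List A
boolFilter p []       = []
boolFilter p (x ∷ xs) = if p x then x ∷ boolFilter p xs else boolFilter p xs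

Matching : ℕ → Set
Matching n = Vec (Fin (n + n)) (n + n)

module _ {n : ℕ} (f : Matching n) where

  partner : Fin (n + n) → ℕ
  partner i = toℕ (lookup f i)

  positions : List (Fin (n + n))
  positions = allFin (n + n)

  isFPFInvolution : Bool
  isFPFInvolution =
    all (λ i → ⌊ lookup f (lookup f i) ≟ i ⌋ ∧ not ⌊ lookup f i ≟ i ⌋) positions

  isNonCrossing : Bool
  isNonCrossing =
    all (λ a → all (λ b →
      not ((toℕ a <ᵇ toℕ b) ∧ (toℕ b <ᵇ partner a) ∧ (partner a <ᵇ partner b)))
      positions) positions

  isTL : Bool
  isTL = isFPFInvolution ∧ isNonCrossing

  -- An arc {a, f a} with a < f a is exposed to the left side iff no other arc
  -- {c, f c} encloses it on the side of the left region, i.e. there is no c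
  -- with c < a and f a < f c.  (The left region touches the boundary exactly
  -- in the gap between position 2n-1 (= 1') and position 0 (= 1).)
  isExposedArcLeftEnd : Fin (n + n) → Bool
  isExposedArcLeftEnd a =
    (toℕ a <ᵇ partner a) ∧
    not (any (λ c → (toℕ c <ᵇ toℕ a) ∧ (partner a <ᵇ partner c)) positions)

  exposedArcs : ℕ
  exposedArcs = countTrue isExposedArcLeftEnd positions

chi : (n k : ℕ) → ℕ
chi n k = countTrue (λ f → isTL {n} f ∧ (exposedArcs {n} f ≡ᵇ k)) (allVecs (n + n) (n + n))

vsum : ∀ {n k} → Vec (Fin n) k → ℕ
vsum v = sum (map toℕ (toList v))

catalanProduct : ∀ {n k} → Vec (Fin n) k → ℕ
catalanProduct v = product (map (λ i → catalan (toℕ i)) (toList v))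

catalanSumQ : (n k : ℕ) → ℕ
catalanSumQ n k =
  sum (map catalanProduct (boolFilter (λ v → vsum v ≡ᵇ (n ∸ k)) (allVecs n k)))

-- The arc {0, 1 + p} through the first position is exposed; the p positions under
-- it carry an arbitrary non-crossing matching, of which there are C_{p/2} for p even and none for
-- p odd, and none of its arcs is exposed; the positions after it carry a matching whose exposed
-- arcs are the remaining exposed arcs.  So χ_{k+1}^{(n+1)} = Σ_i C_i χ_k^{(n-i)}, with the total
-- count Σ_k χ_k^{(n)} = C_n following from the Catalan convolution C_{n+1} = Σ_i C_i C_{n-i}.
-- Splitting off the first index i₁ shows that the sum over Q(n, k) satisfies the same recursion:
-- both are the coefficient of xⁿ in (x C(x))ᵏ.

module Submission where

open import Defs
open import Data.Nat
open import Data.Nat.Properties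
open import Data.Nat.Combinatorics using (_C_; nCk+nC[k+1]≡[n+1]C[k+1]; nCk≡nC[n∸k]; nC1≡n)
open import Data.Nat.Combinatorics.Specification using (k>n⇒nCk≡0)
open import Data.Nat.DivMod using (m*n/n≡m)
open import Data.Nat.Induction using (<-rec)
open import Data.Nat.Tactic.RingSolver using (solve-∀)
open import Data.Bool using (Bool; true; false; if_then_else_; _∧_; not; T)
open import Data.Bool.ListAction using (and; or; all; any)
open import Data.Bool.Properties using (T-∧)
open import Data.Fin using (Fin; toℕ) renaming (zero to fzero; suc to fsuc)
import Data.Fin.Properties as Fin
open import Data.List using (List; []; _∷_; map; concatMap; _++_; length; allFin; tabulate; applyUpTo; upTo)
open import Data.List.Properties using (map-++; map-∘; map-cong)
open import Data.Nat.ListAction using (sum; product)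
open import Data.Nat.ListAction.Properties using (sum-++)
open import Data.Empty using (⊥; ⊥-elim)
open import Data.Product using (_×_; _,_; proj₁; proj₂; ∃-syntax)
import Data.List.Relation.Unary.All.Properties as All
import Data.List.Relation.Unary.Any.Properties as Any
open import Data.Vec using (Vec; _∷_; lookup; toList)
open import Relation.Nullary using (¬_; yes; no)
open import Relation.Nullary.Decidable using (⌊_⌋)
open import Function using (_∘_; id)
open import Function.Bundles using (module Equivalence)
open Equivalence using (to; from)
open import Relation.Binary using (tri<; tri≈; tri>)
open import Relation.Binary.PropositionalEquality

sumBelow : (ℕ → ℕ) → ℕ → ℕ
sumBelow f zero    = 0
sumBelow f (suc n) = f 0 + sumBelow (f ∘ suc) n

sumBelow-cong : ∀ {f g : ℕ → ℕ} n → (∀ i → i < n → f i ≡ g i) → sumBelow f n ≡ sumBelow g n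
sumBelow-cong zero    f≡g = refl
sumBelow-cong (suc n) f≡g = cong₂ _+_ (f≡g 0 z<s) (sumBelow-cong n (λ i i<n → f≡g (suc i) (s<s i<n)))

sumBelow-ext : ∀ {f g : ℕ → ℕ} n → (∀ i → f i ≡ g i) → sumBelow f n ≡ sumBelow g n
sumBelow-ext n f≡g = sumBelow-cong n (λ i _ → f≡g i)

sumBelow-zero : ∀ {f : ℕ → ℕ} n → (∀ i → i < n → f i ≡ 0) → sumBelow f n ≡ 0
sumBelow-zero zero    f≡0 = refl
sumBelow-zero (suc n) f≡0 = cong₂ _+_ (f≡0 0 z<s) (sumBelow-zero n (λ i i<n → f≡0 (suc i) (s<s i<n)))

sumBelow-+ : ∀ (f g : ℕ → ℕ) n → sumBelow (λ i → f i + g i) n ≡ sumBelow f n + sumBelow g n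
sumBelow-+ f g zero    = refl
sumBelow-+ f g (suc n) rewrite sumBelow-+ (f ∘ suc) (g ∘ suc) n =
  +-+-interchange (f 0) (g 0) (sumBelow (f ∘ suc) n) (sumBelow (g ∘ suc) n)
  where
  +-+-interchange : ∀ a b c d → a + b + (c + d) ≡ a + c + (b + d)
  +-+-interchange = solve-∀

sumBelow-*ˡ : ∀ c (f : ℕ → ℕ) n → sumBelow (λ i → c * f i) n ≡ c * sumBelow f n
sumBelow-*ˡ c f zero    = sym (*-zeroʳ c)
sumBelow-*ˡ c f (suc n) rewrite sumBelow-*ˡ c (f ∘ suc) n = sym (*-distribˡ-+ c (f 0) _)

sumBelow-sucʳ : ∀ (f : ℕ → ℕ) n → sumBelow f (suc n) ≡ sumBelow f n + f n
sumBelow-sucʳ f zero    = +-comm (f 0) 0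
sumBelow-sucʳ f (suc n) rewrite sumBelow-sucʳ (f ∘ suc) n = sym (+-assoc (f 0) _ _)

sumBelow-+-split : ∀ (f : ℕ → ℕ) m n → sumBelow f (m + n) ≡ sumBelow f m + sumBelow (λ i → f (m + i)) n
sumBelow-+-split f zero    n = refl
sumBelow-+-split f (suc m) n rewrite sumBelow-+-split (f ∘ suc) m n = sym (+-assoc (f 0) _ _)

sumBelow-reverse : ∀ (f : ℕ → ℕ) n → sumBelow f n ≡ sumBelow (λ i → f (n ∸ suc i)) n
sumBelow-reverse f zero    = refl
sumBelow-reverse f (suc n) = begin
  f 0 + sumBelow (f ∘ suc) n
    ≡⟨ cong (f 0 +_) (sumBelow-reverse (f ∘ suc) n) ⟩
  f 0 + sumBelow (λ i → f (suc (n ∸ suc i))) n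
    ≡⟨ +-comm (f 0) _ ⟩
  sumBelow (λ i → f (suc (n ∸ suc i))) n + f 0
    ≡⟨ cong₂ _+_ (sumBelow-cong n (λ i i<n → cong f (sym (+-∸-assoc 1 i<n)))) (cong f (sym (n∸n≡0 n))) ⟩
  sumBelow (λ i → f (suc n ∸ suc i)) n + f (suc n ∸ suc n)
    ≡⟨ sym (sumBelow-sucʳ (λ i → f (suc n ∸ suc i)) n) ⟩
  sumBelow (λ i → f (suc n ∸ suc i)) (suc n) ∎
  where open ≡-Reasoning

sumBelow-comm : ∀ (f : ℕ → ℕ → ℕ) m n →
                sumBelow (λ i → sumBelow (f i) m) n ≡ sumBelow (λ j → sumBelow (λ i → f i j) n) m
sumBelow-comm f m zero    = sym (sumBelow-zero m (λ _ _ → refl))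
sumBelow-comm f m (suc n) = begin
  sumBelow (f 0) m + sumBelow (λ i → sumBelow (f (suc i)) m) n
    ≡⟨ cong (sumBelow (f 0) m +_) (sumBelow-comm (f ∘ suc) m n) ⟩
  sumBelow (f 0) m + sumBelow (λ j → sumBelow (λ i → f (suc i) j) n) m
    ≡⟨ sym (sumBelow-+ (f 0) _ m) ⟩
  sumBelow (λ j → f 0 j + sumBelow (λ i → f (suc i) j) n) m ∎
  where open ≡-Reasoning

sumBelow-even+odd : ∀ (f : ℕ → ℕ) n → sumBelow f (n + n) ≡ sumBelow (λ j → f (j + j) + f (suc (j + j))) n
sumBelow-even+odd f zero    = refl
sumBelow-even+odd f (suc n) = begin
  f 0 + sumBelow (f ∘ suc) (n + suc n)
    ≡⟨ cong (λ m → f 0 + sumBelow (f ∘ suc) m) (+-suc n n) ⟩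
  f 0 + (f 1 + sumBelow (f ∘ suc ∘ suc) (n + n))
    ≡⟨ sym (+-assoc (f 0) _ _) ⟩
  f 0 + f 1 + sumBelow (f ∘ suc ∘ suc) (n + n)
    ≡⟨ cong (f 0 + f 1 +_) (sumBelow-even+odd (f ∘ suc ∘ suc) n) ⟩
  f 0 + f 1 + sumBelow (λ j → f (2 + (j + j)) + f (3 + (j + j))) n
    ≡⟨ cong (f 0 + f 1 +_) (sumBelow-ext n (λ j → cong (λ m → f m + f (suc m)) (sym (+-suc (suc j) j)))) ⟩
  f 0 + f 1 + sumBelow (λ j → f (suc j + suc j) + f (suc (suc j + suc j))) n ∎
  where open ≡-Reasoning

-- Catalan numbers

[1+k]*[1+m]C[1+k]≡[1+m]*mCk : ∀ m k → suc k * (suc m C suc k) ≡ suc m * (m C k)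
[1+k]*[1+m]C[1+k]≡[1+m]*mCk zero zero = refl
[1+k]*[1+m]C[1+k]≡[1+m]*mCk zero (suc k)
  rewrite k>n⇒nCk≡0 {1} {suc (suc k)} (s<s z<s) | k>n⇒nCk≡0 {0} {suc k} z<s = *-zeroʳ (suc (suc k))
[1+k]*[1+m]C[1+k]≡[1+m]*mCk (suc m) zero = trans (*-identityˡ _) (trans (nC1≡n (suc (suc m))) (sym (*-identityʳ _)))
[1+k]*[1+m]C[1+k]≡[1+m]*mCk (suc m) (suc k) = begin
  suc (suc k) * (suc (suc m) C suc (suc k))
    ≡⟨ cong (suc (suc k) *_) (sym (nCk+nC[k+1]≡[n+1]C[k+1] (suc m) (suc k))) ⟩
  suc (suc k) * (a + b)
    ≡⟨ split k a b ⟩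
  suc k * a + a + suc (suc k) * b
    ≡⟨ cong₂ (λ u v → u + a + v) ([1+k]*[1+m]C[1+k]≡[1+m]*mCk m k) ([1+k]*[1+m]C[1+k]≡[1+m]*mCk m (suc k)) ⟩
  suc m * x + a + suc m * y
    ≡⟨ collect m x a y ⟩
  suc m * (x + y) + a
    ≡⟨ cong (λ u → suc m * u + a) (nCk+nC[k+1]≡[n+1]C[k+1] m k) ⟩
  suc m * a + a
    ≡⟨ +-comm (suc m * a) a ⟩
  suc (suc m) * a ∎
  where
  open ≡-Reasoning
  a = suc m C suc k
  b = suc m C suc (suc k)
  x = m C k
  y = m C suc k
  split : ∀ k a b → suc (suc k) * (a + b) ≡ suc k * a + a + suc (suc k) * b
  split = solve-∀
  collect : ∀ m x a y → suc m * x + a + suc m * y ≡ suc m * (x + y) + a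
  collect = solve-∀

[1+n]*[2n]C[1+n]≡n*[2n]Cn : ∀ n → suc n * ((n + n) C suc n) ≡ n * ((n + n) C n)
[1+n]*[2n]C[1+n]≡n*[2n]Cn n = +-cancelʳ-≡ (suc n * b) _ _ (begin
  suc n * e + suc n * b ≡⟨ sym (*-distribˡ-+ (suc n) e b) ⟩
  suc n * (e + b)       ≡⟨ cong (suc n *_) (+-comm e b) ⟩
  suc n * (b + e)       ≡⟨ cong (suc n *_) (nCk+nC[k+1]≡[n+1]C[k+1] (n + n) n) ⟩
  suc n * (suc (n + n) C suc n) ≡⟨ [1+k]*[1+m]C[1+k]≡[1+m]*mCk (n + n) n ⟩
  suc (n + n) * b       ≡⟨ regroup n b ⟩
  n * b + suc n * b     ∎)
  where
  open ≡-Reasoning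
  b = (n + n) C n
  e = (n + n) C suc n
  regroup : ∀ n b → suc (n + n) * b ≡ n * b + suc n * b
  regroup = solve-∀

[2n]Cn≡[1+n]*[[2n]Cn∸[2n]C[1+n]] : ∀ n → (n + n) C n ≡ suc n * ((n + n) C n ∸ (n + n) C suc n)
[2n]Cn≡[1+n]*[[2n]Cn∸[2n]C[1+n]] n = begin
  b                         ≡⟨ sym (m+n∸n≡m b (n * b)) ⟩
  b + n * b ∸ n * b         ≡⟨ cong (b + n * b ∸_) (sym ([1+n]*[2n]C[1+n]≡n*[2n]Cn n)) ⟩
  suc n * b ∸ suc n * e     ≡⟨ sym (*-distribˡ-∸ (suc n) b e) ⟩
  suc n * (b ∸ e)           ∎
  where
  open ≡-Reasoning
  b = (n + n) C n
  e = (n + n) C suc n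

[1+n]*catalan[n]≡[2n]Cn : ∀ n → suc n * catalan n ≡ (n + n) C n
[1+n]*catalan[n]≡[2n]Cn n = begin
  suc n * (b / suc n)             ≡⟨ cong (λ c → suc n * (c / suc n)) b≡ ⟩
  suc n * ((b ∸ e) * suc n / suc n) ≡⟨ cong (suc n *_) (m*n/n≡m (b ∸ e) (suc n)) ⟩
  suc n * (b ∸ e)                 ≡⟨ sym ([2n]Cn≡[1+n]*[[2n]Cn∸[2n]C[1+n]] n) ⟩
  b                               ∎
  where
  open ≡-Reasoning
  b = (n + n) C n
  e = (n + n) C suc n
  b≡ : b ≡ (b ∸ e) * suc n
  b≡ = trans ([2n]Cn≡[1+n]*[[2n]Cn∸[2n]C[1+n]] n) (*-comm (suc n) (b ∸ e))

[1+n]*[2+2n]C[1+n]≡2*[1+2n]*[2n]Cn : ∀ n → suc n * ((suc n + suc n) C suc n) ≡ 2 * (suc (n + n) * ((n + n) C n))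
[1+n]*[2+2n]C[1+n]≡2*[1+2n]*[2n]Cn n = begin
  suc n * ((suc n + suc n) C suc n)   ≡⟨ cong (λ m → suc n * (m C suc n)) (+-suc (suc n) n) ⟩
  suc n * (suc (suc (n + n)) C suc n) ≡⟨ cong (suc n *_) (sym (nCk+nC[k+1]≡[n+1]C[k+1] (suc (n + n)) n)) ⟩
  suc n * (x + y)                     ≡⟨ cong (λ z → suc n * (z + y)) x≡y ⟩
  suc n * (y + y)                     ≡⟨ double (suc n) y ⟩
  2 * (suc n * y)                     ≡⟨ cong (2 *_) ([1+k]*[1+m]C[1+k]≡[1+m]*mCk (n + n) n) ⟩
  2 * (suc (n + n) * ((n + n) C n))   ∎
  where
  open ≡-Reasoning
  x = suc (n + n) C n
  y = suc (n + n) C suc n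
  double : ∀ a y → a * (y + y) ≡ 2 * (a * y)
  double = solve-∀
  x≡y : x ≡ y
  x≡y = trans (nCk≡nC[n∸k] (≤-trans (m≤m+n n n) (n≤1+n _)))
              (cong (suc (n + n) C_) (trans (+-∸-assoc 1 (m≤m+n n n)) (cong suc (m+n∸m≡n n n))))

[2+n]*catalan[1+n]≡[2+4n]*catalan[n] : ∀ n → suc (suc n) * catalan (suc n) ≡ (2 + 4 * n) * catalan n
[2+n]*catalan[1+n]≡[2+4n]*catalan[n] n = *-cancelˡ-≡ _ _ (suc n) (begin
  suc n * (suc (suc n) * catalan (suc n)) ≡⟨ cong (suc n *_) ([1+n]*catalan[n]≡[2n]Cn (suc n)) ⟩
  suc n * ((suc n + suc n) C suc n)       ≡⟨ [1+n]*[2+2n]C[1+n]≡2*[1+2n]*[2n]Cn n ⟩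
  2 * (suc (n + n) * ((n + n) C n))       ≡⟨ cong (λ b → 2 * (suc (n + n) * b)) (sym ([1+n]*catalan[n]≡[2n]Cn n)) ⟩
  2 * (suc (n + n) * (suc n * catalan n)) ≡⟨ regroup n (catalan n) ⟩
  suc n * ((2 + 4 * n) * catalan n)       ∎)
  where
  open ≡-Reasoning
  regroup : ∀ n c → 2 * (suc (n + n) * (suc n * c)) ≡ suc n * ((2 + 4 * n) * c)
  regroup = solve-∀

catalanPair : ℕ → ℕ → ℕ
catalanPair n i = catalan i * catalan (n ∸ i)

catalanConvolution : ℕ → ℕ
catalanConvolution n = sumBelow (catalanPair n) (suc n)

-- Pair the term of index i with the term of index n ∸ i.
2*∑i*catalanPair≡n*catalanConvolution : ∀ n →
  2 * sumBelow (λ i → i * catalanPair n i) (suc n) ≡ n * catalanConvolution n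
2*∑i*catalanPair≡n*catalanConvolution n = begin
  2 * A                                          ≡⟨ cong (A +_) (+-identityʳ A) ⟩
  A + A                                          ≡⟨ cong (A +_) reversed ⟩
  A + sumBelow (λ i → (n ∸ i) * P i) (suc n)     ≡⟨ sym (sumBelow-+ (λ i → i * P i) (λ i → (n ∸ i) * P i) (suc n)) ⟩
  sumBelow (λ i → i * P i + (n ∸ i) * P i) (suc n) ≡⟨ sumBelow-cong (suc n) (λ i i≤n → weights (≤-pred i≤n)) ⟩
  sumBelow (λ i → n * P i) (suc n)               ≡⟨ sumBelow-*ˡ n P (suc n) ⟩
  n * catalanConvolution n                       ∎
  where
  open ≡-Reasoning
  P = catalanPair n
  A = sumBelow (λ i → i * P i) (suc n)
  weights : ∀ {i} → i ≤ n → i * P i + (n ∸ i) * P i ≡ n * P i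
  weights {i} i≤n = trans (sym (*-distribʳ-+ (P i) i (n ∸ i))) (cong (_* P i) (m+[n∸m]≡n i≤n))
  reflect : ∀ i → i ≤ n → (n ∸ i) * P (n ∸ i) ≡ (n ∸ i) * P i
  reflect i i≤n = cong ((n ∸ i) *_) (trans (cong (catalan (n ∸ i) *_) (cong catalan (m∸[m∸n]≡n i≤n)))
                                            (*-comm (catalan (n ∸ i)) (catalan i)))
  reversed : A ≡ sumBelow (λ i → (n ∸ i) * P i) (suc n)
  reversed = trans (sumBelow-reverse (λ i → i * P i) (suc n)) (sumBelow-cong (suc n) (λ i i≤n → reflect i (≤-pred i≤n)))

2*∑[1+i]*catalanPair≡[2+n]*catalanConvolution : ∀ n →
  2 * sumBelow (λ i → suc i * catalanPair n i) (suc n) ≡ (2 + n) * catalanConvolution n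
2*∑[1+i]*catalanPair≡[2+n]*catalanConvolution n = begin
  2 * sumBelow (λ i → P i + i * P i) (suc n) ≡⟨ cong (2 *_) (sumBelow-+ P (λ i → i * P i) (suc n)) ⟩
  2 * (S + B)                                ≡⟨ *-distribˡ-+ 2 S B ⟩
  2 * S + 2 * B                              ≡⟨ cong (2 * S +_) (2*∑i*catalanPair≡n*catalanConvolution n) ⟩
  2 * S + n * S                              ≡⟨ sym (*-distribʳ-+ S 2 n) ⟩
  (2 + n) * S                                ∎
  where
  open ≡-Reasoning
  P = catalanPair n
  S = catalanConvolution n
  B = sumBelow (λ i → i * P i) (suc n)

∑[1+i]*catalanPair[1+n]≡catalan[1+n]+∑[2+4i]*catalanPair[n] : ∀ n →
  sumBelow (λ i → suc i * catalanPair (suc n) i) (suc (suc n))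
    ≡ catalan (suc n) + sumBelow (λ i → (2 + 4 * i) * catalanPair n i) (suc n)
∑[1+i]*catalanPair[1+n]≡catalan[1+n]+∑[2+4i]*catalanPair[n] n =
  cong₂ _+_ (trans (*-identityˡ (1 * catalan (suc n))) (*-identityˡ (catalan (suc n))))
            (sumBelow-ext {λ i → suc (suc i) * catalanPair (suc n) (suc i)} (suc n) term)
  where
  term : ∀ i → suc (suc i) * (catalan (suc i) * catalan (n ∸ i)) ≡ (2 + 4 * i) * catalanPair n i
  term i = begin
    suc (suc i) * (catalan (suc i) * catalan (n ∸ i)) ≡⟨ sym (*-assoc (suc (suc i)) (catalan (suc i)) (catalan (n ∸ i))) ⟩
    suc (suc i) * catalan (suc i) * catalan (n ∸ i)   ≡⟨ cong (_* catalan (n ∸ i)) ([2+n]*catalan[1+n]≡[2+4n]*catalan[n] i) ⟩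
    (2 + 4 * i) * catalan i * catalan (n ∸ i)         ≡⟨ *-assoc (2 + 4 * i) (catalan i) (catalan (n ∸ i)) ⟩
    (2 + 4 * i) * catalanPair n i                     ∎
    where open ≡-Reasoning

catalan[1+n]≡catalanConvolution : ∀ n → catalan (suc n) ≡ catalanConvolution n
catalan[1+n]≡catalanConvolution zero    = refl
catalan[1+n]≡catalanConvolution (suc m) = *-cancelˡ-≡ _ _ (suc (suc (suc m))) (begin
  suc (suc (suc m)) * catalan (suc (suc m))   ≡⟨ [2+n]*catalan[1+n]≡[2+4n]*catalan[n] (suc m) ⟩
  (2 + 4 * suc m) * c                         ≡⟨ regroup m c ⟩
  2 * (c + (2 * c + 2 * (m * c)))             ≡⟨ cong (λ x → 2 * (c + (2 * x + 2 * (m * x)))) (catalan[1+n]≡catalanConvolution m) ⟩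
  2 * (c + (2 * S + 2 * (m * S)))             ≡⟨ cong (λ x → 2 * (c + (2 * S + x))) (cong (2 *_) (sym (2*∑i*catalanPair≡n*catalanConvolution m))) ⟩
  2 * (c + (2 * S + 2 * (2 * B)))             ≡⟨ cong (λ x → 2 * (c + x)) (sym weighted) ⟩
  2 * (c + sumBelow (λ i → (2 + 4 * i) * P i) (suc m))
    ≡⟨ cong (2 *_) (sym (∑[1+i]*catalanPair[1+n]≡catalan[1+n]+∑[2+4i]*catalanPair[n] m)) ⟩
  2 * sumBelow (λ i → suc i * catalanPair (suc m) i) (suc (suc m))
    ≡⟨ 2*∑[1+i]*catalanPair≡[2+n]*catalanConvolution (suc m) ⟩
  (2 + suc m) * catalanConvolution (suc m)    ∎)
  where
  open ≡-Reasoning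
  c = catalan (suc m)
  P = catalanPair m
  S = catalanConvolution m
  B = sumBelow (λ i → i * P i) (suc m)
  regroup : ∀ m c → (2 + 4 * suc m) * c ≡ 2 * (c + (2 * c + 2 * (m * c)))
  regroup = solve-∀
  split : ∀ i p → (2 + 4 * i) * p ≡ 2 * p + 2 * (2 * (i * p))
  split = solve-∀
  weighted : sumBelow (λ i → (2 + 4 * i) * P i) (suc m) ≡ 2 * S + 2 * (2 * B)
  weighted = begin
    sumBelow (λ i → (2 + 4 * i) * P i) (suc m)
      ≡⟨ sumBelow-ext (suc m) (λ i → split i (P i)) ⟩
    sumBelow (λ i → 2 * P i + 2 * (2 * (i * P i))) (suc m)
      ≡⟨ sumBelow-+ (λ i → 2 * P i) (λ i → 2 * (2 * (i * P i))) (suc m) ⟩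
    sumBelow (λ i → 2 * P i) (suc m) + sumBelow (λ i → 2 * (2 * (i * P i))) (suc m)
      ≡⟨ cong₂ _+_ (sumBelow-*ˡ 2 P (suc m))
                   (trans (sumBelow-*ˡ 2 (λ i → 2 * (i * P i)) (suc m)) (cong (2 *_) (sumBelow-*ˡ 2 (λ i → i * P i) (suc m)))) ⟩
    2 * S + 2 * (2 * B) ∎

-- catalanPower n k is the coefficient of xⁿ in (x C(x))ᵏ, where C(x) = Σ catalan m xᵐ.
catalanPower : ℕ → ℕ → ℕ
catalanPower zero    zero    = 1
catalanPower zero    (suc k) = 0
catalanPower (suc n) zero    = 0
catalanPower (suc n) (suc k) = sumBelow (λ i → catalan i * catalanPower (n ∸ i) k) (suc n)

catalanPower-vanishes : ∀ n k → n < k → catalanPower n k ≡ 0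
catalanPower-vanishes zero    (suc k) _         = refl
catalanPower-vanishes (suc n) (suc k) (s<s n<k) = sumBelow-zero (suc n) (λ i _ →
  trans (cong (catalan i *_) (catalanPower-vanishes (n ∸ i) k (≤-<-trans (m∸n≤m n i) n<k))) (*-zeroʳ (catalan i)))

-- Σₖ (x C(x))ᵏ = 1 / (1 - x C(x)) = C(x).
sumBelow-catalanPower : ∀ n B → n < B → sumBelow (catalanPower n) B ≡ catalan n
sumBelow-catalanPower n B = bounded n n B ≤-refl
  where
  bounded : ∀ bound n B → n ≤ bound → n < B → sumBelow (catalanPower n) B ≡ catalan n
  bounded bound       zero    (suc B) _ _ = cong suc (sumBelow-zero B (λ _ _ → refl))
  bounded (suc bound) (suc m) (suc B) (s≤s m≤bound) (s<s m<B) = begin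
    sumBelow (λ k → sumBelow (λ i → catalan i * catalanPower (m ∸ i) k) (suc m)) B
      ≡⟨ sumBelow-comm (λ k i → catalan i * catalanPower (m ∸ i) k) (suc m) B ⟩
    sumBelow (λ i → sumBelow (λ k → catalan i * catalanPower (m ∸ i) k) B) (suc m)
      ≡⟨ sumBelow-cong (suc m) (λ i _ → trans (sumBelow-*ˡ (catalan i) (catalanPower (m ∸ i)) B)
             (cong (catalan i *_) (bounded bound (m ∸ i) B (≤-trans (m∸n≤m m i) m≤bound) (≤-<-trans (m∸n≤m m i) m<B)))) ⟩
    catalanConvolution m
      ≡⟨ sym (catalan[1+n]≡catalanConvolution m) ⟩
    catalan (suc m) ∎
    where open ≡-Reasoning

-- Sums over lists and over tuples

indicator : Bool → ℕ
indicator true  = 1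
indicator false = 0

indicator-∧ : ∀ a b → indicator (a ∧ b) ≡ indicator a * indicator b
indicator-∧ true  b = sym (+-identityʳ (indicator b))
indicator-∧ false b = refl

T-⇔⇒≡ : ∀ {a b} → (T a → T b) → (T b → T a) → a ≡ b
T-⇔⇒≡ {false} {false} _   _   = refl
T-⇔⇒≡ {false} {true}  _   b⇒a = ⊥-elim (b⇒a _)
T-⇔⇒≡ {true}  {false} a⇒b _   = ⊥-elim (a⇒b _)
T-⇔⇒≡ {true}  {true}  _   _   = refl

T⇒indicator≡1 : ∀ {b} → T b → indicator b ≡ 1
T⇒indicator≡1 {true} _ = refl

¬T⇒indicator≡0 : ∀ {b} → ¬ T b → indicator b ≡ 0
¬T⇒indicator≡0 {true}  ¬b = ⊥-elim (¬b _)
¬T⇒indicator≡0 {false} _  = refl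

countTrue≡sum-map-indicator : ∀ {A : Set} (p : A → Bool) xs → countTrue p xs ≡ sum (map (indicator ∘ p) xs)
countTrue≡sum-map-indicator p []       = refl
countTrue≡sum-map-indicator p (x ∷ xs) with p x
... | true  = cong suc (countTrue≡sum-map-indicator p xs)
... | false = countTrue≡sum-map-indicator p xs

sum-map-boolFilter : ∀ {A : Set} (p : A → Bool) (f : A → ℕ) xs →
                     sum (map f (boolFilter p xs)) ≡ sum (map (λ x → if p x then f x else 0) xs)
sum-map-boolFilter p f []       = refl
sum-map-boolFilter p f (x ∷ xs) with p x
... | true  = cong (f x +_) (sum-map-boolFilter p f xs)
... | false = sum-map-boolFilter p f xs

sum-map-concatMap : ∀ {A B : Set} (f : B → ℕ) (g : A → List B) xs →
                    sum (map f (concatMap g xs)) ≡ sum (map (λ x → sum (map f (g x))) xs)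
sum-map-concatMap f g []       = refl
sum-map-concatMap f g (x ∷ xs) = begin
  sum (map f (g x ++ concatMap g xs))              ≡⟨ cong sum (map-++ f (g x) (concatMap g xs)) ⟩
  sum (map f (g x) ++ map f (concatMap g xs))      ≡⟨ sum-++ (map f (g x)) (map f (concatMap g xs)) ⟩
  sum (map f (g x)) + sum (map f (concatMap g xs)) ≡⟨ cong (sum (map f (g x)) +_) (sum-map-concatMap f g xs) ⟩
  sum (map f (g x)) + sum (map (λ x → sum (map f (g x))) xs) ∎
  where open ≡-Reasoning

sum-map-applyUpTo : ∀ (f h : ℕ → ℕ) N → sum (map f (applyUpTo h N)) ≡ sumBelow (f ∘ h) N
sum-map-applyUpTo f h zero    = refl
sum-map-applyUpTo f h (suc N) = cong (f (h 0) +_) (sum-map-applyUpTo f (h ∘ suc) N)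

map-allFin≡map-upTo : ∀ {A : Set} N (p : Fin N → A) (q : ℕ → A) →
                      (∀ i → p i ≡ q (toℕ i)) → map p (allFin N) ≡ map q (upTo N)
map-allFin≡map-upTo N p q p≡q = tabulated N id id (λ _ → refl)
  where
  tabulated : ∀ K (h : Fin K → Fin N) (h′ : ℕ → ℕ) → (∀ i → toℕ (h i) ≡ h′ (toℕ i)) →
              map p (tabulate h) ≡ map q (applyUpTo h′ K)
  tabulated zero    h h′ h≡h′ = refl
  tabulated (suc K) h h′ h≡h′ =
    cong₂ _∷_ (trans (p≡q (h fzero)) (cong q (h≡h′ fzero))) (tabulated K (h ∘ fsuc) (h′ ∘ suc) (h≡h′ ∘ fsuc))

-- Lists are read as functions ℕ → ℕ that vanish past the end.
nth : List ℕ → ℕ → ℕ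
nth []       i       = 0
nth (x ∷ xs) zero    = x
nth (x ∷ xs) (suc i) = nth xs i

nth-++ˡ : ∀ u w i → i < length u → nth (u ++ w) i ≡ nth u i
nth-++ˡ (x ∷ u) w zero    _         = refl
nth-++ˡ (x ∷ u) w (suc i) (s<s i<u) = nth-++ˡ u w i i<u

nth-++ʳ : ∀ u w j → nth (u ++ w) (length u + j) ≡ nth w j
nth-++ʳ []      w j = refl
nth-++ʳ (x ∷ u) w j = nth-++ʳ u w j

nth-map-∸ : ∀ s u i → nth (map (_∸ s) u) i ≡ nth u i ∸ s
nth-map-∸ s []      i       = sym (0∸n≡0 s)
nth-map-∸ s (x ∷ u) zero    = refl
nth-map-∸ s (x ∷ u) (suc i) = nth-map-∸ s u i

IsTuple : ℕ → ℕ → List ℕ → Set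
IsTuple M L l = (length l ≡ L) × (∀ i → i < L → nth l i < M)

IsTuple-∷ : ∀ {M L l x} → x < M → IsTuple M L l → IsTuple M (suc L) (x ∷ l)
IsTuple-∷ x<M (refl , l<M) = refl , λ { zero _ → x<M ; (suc i) (s≤s i<L) → l<M i i<L }

sumTuples : ℕ → ℕ → (List ℕ → ℕ) → ℕ
sumTuples M zero    f = f []
sumTuples M (suc L) f = sumBelow (λ x → sumTuples M L (f ∘ (x ∷_))) M

sumTuples-cong : ∀ M L {f g : List ℕ → ℕ} → (∀ l → IsTuple M L l → f l ≡ g l) → sumTuples M L f ≡ sumTuples M L g
sumTuples-cong M zero    f≡g = f≡g [] (refl , λ _ ())
sumTuples-cong M (suc L) f≡g =
  sumBelow-cong M (λ x x<M → sumTuples-cong M L (λ l l∈ → f≡g (x ∷ l) (IsTuple-∷ x<M l∈)))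

sumTuples-zero : ∀ M L {f : List ℕ → ℕ} → (∀ l → f l ≡ 0) → sumTuples M L f ≡ 0
sumTuples-zero M zero    f≡0 = f≡0 []
sumTuples-zero M (suc L) f≡0 = sumBelow-zero M (λ x _ → sumTuples-zero M L (f≡0 ∘ (x ∷_)))

sumTuples-*ˡ : ∀ M L c (f : List ℕ → ℕ) → sumTuples M L (λ l → c * f l) ≡ c * sumTuples M L f
sumTuples-*ˡ M zero    c f = refl
sumTuples-*ˡ M (suc L) c f =
  trans (sumBelow-ext M (λ x → sumTuples-*ˡ M L c (f ∘ (x ∷_)))) (sumBelow-*ˡ c (λ x → sumTuples M L (f ∘ (x ∷_))) M)

sumTuples-++ : ∀ M a b (f : List ℕ → ℕ) → sumTuples M (a + b) f ≡ sumTuples M a (λ u → sumTuples M b (f ∘ (u ++_)))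
sumTuples-++ M zero    b f = refl
sumTuples-++ M (suc a) b f = sumBelow-ext M (λ x → sumTuples-++ M a b (f ∘ (x ∷_)))

sumTuples-sumBelow : ∀ M L B (f : List ℕ → ℕ → ℕ) →
                     sumTuples M L (λ l → sumBelow (f l) B) ≡ sumBelow (λ k → sumTuples M L (λ l → f l k)) B
sumTuples-sumBelow M zero    B f = refl
sumTuples-sumBelow M (suc L) B f =
  trans (sumBelow-ext M (λ x → sumTuples-sumBelow M L B (f ∘ (x ∷_))))
        (sumBelow-comm (λ x k → sumTuples M L (λ l → f (x ∷ l) k)) B M)

inWindowᵇ : ℕ → ℕ → ℕ → Bool
inWindowᵇ s K x = (s ≤ᵇ x) ∧ (x <ᵇ s + K)

sumBelow-window : ∀ s K M (h : ℕ → ℕ) → s + K ≤ M →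
                  sumBelow (λ x → indicator (inWindowᵇ s K x) * h (x ∸ s)) M ≡ sumBelow h K
sumBelow-window s K M h s+K≤M = begin
  sumBelow f M
    ≡⟨ cong (sumBelow f) M≡s+[K+t] ⟩
  sumBelow f (s + (K + t))
    ≡⟨ sumBelow-+-split f s (K + t) ⟩
  sumBelow f s + sumBelow (λ i → f (s + i)) (K + t)
    ≡⟨ cong (sumBelow f s +_) (sumBelow-+-split (λ i → f (s + i)) K t) ⟩
  sumBelow f s + (sumBelow (λ i → f (s + i)) K + sumBelow (λ i → f (s + (K + i))) t)
    ≡⟨ cong₂ _+_ (sumBelow-zero s below) (cong₂ _+_ (sumBelow-cong K inside) (sumBelow-zero t (λ i _ → above i))) ⟩
  0 + (sumBelow h K + 0)
    ≡⟨ +-identityʳ (sumBelow h K) ⟩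
  sumBelow h K ∎
  where
  open ≡-Reasoning
  f = λ x → indicator (inWindowᵇ s K x) * h (x ∸ s)
  t = M ∸ (s + K)
  M≡s+[K+t] : M ≡ s + (K + t)
  M≡s+[K+t] = trans (sym (m+[n∸m]≡n s+K≤M)) (+-assoc s K t)
  below : ∀ i → i < s → f i ≡ 0
  below i i<s = cong (_* h (i ∸ s))
    (¬T⇒indicator≡0 (λ w → <⇒≱ i<s (≤ᵇ⇒≤ s i (proj₁ (to T-∧ w)))))
  inside : ∀ i → i < K → f (s + i) ≡ h i
  inside i i<K = begin
    indicator (inWindowᵇ s K (s + i)) * h (s + i ∸ s)
      ≡⟨ cong₂ _*_ (T⇒indicator≡1 (from T-∧ (≤⇒≤ᵇ (m≤m+n s i) , <⇒<ᵇ (+-monoʳ-< s i<K))))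
                   (cong h (m+n∸m≡n s i)) ⟩
    1 * h i
      ≡⟨ *-identityˡ (h i) ⟩
    h i ∎
  above : ∀ i → f (s + (K + i)) ≡ 0
  above i = cong (_* h (s + (K + i) ∸ s)) (¬T⇒indicator≡0 {inWindowᵇ s K (s + (K + i))} (λ w →
    <⇒≱ (<ᵇ⇒< (s + (K + i)) (s + K) (proj₂ (to (T-∧ {s ≤ᵇ s + (K + i)}) w)))
        (subst (s + K ≤_) (+-assoc s K i) (m≤m+n (s + K) i))))

inRangeᵇ : ℕ → ℕ → List ℕ → Bool
inRangeᵇ s K = all (inWindowᵇ s K)

inRangeᵇ⇒ : ∀ s K w → T (inRangeᵇ s K w) → ∀ j → j < length w → s ≤ nth w j × nth w j < s + K
inRangeᵇ⇒ s K (x ∷ w) t zero    _         = let (s≤x , x<s+K) = to T-∧ (proj₁ (to T-∧ t)) in ≤ᵇ⇒≤ s x s≤x , <ᵇ⇒< x (s + K) x<s+K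
inRangeᵇ⇒ s K (x ∷ w) t (suc j) (s<s j<w) = inRangeᵇ⇒ s K w (proj₂ (to (T-∧ {inWindowᵇ s K x}) t)) j j<w

inRangeᵇ⇐ : ∀ s K w → (∀ j → j < length w → s ≤ nth w j × nth w j < s + K) → T (inRangeᵇ s K w)
inRangeᵇ⇐ s K []      _        = _
inRangeᵇ⇐ s K (x ∷ w) inRange = from T-∧
  ( from T-∧ (≤⇒≤ᵇ (proj₁ (inRange 0 z<s)) , <⇒<ᵇ (proj₂ (inRange 0 z<s)))
  , inRangeᵇ⇐ s K w (λ j j<w → inRange (suc j) (s<s j<w)) )

sumTuples-shift : ∀ M s K L (f : List ℕ → ℕ) → s + K ≤ M →
                  sumTuples M L (λ w → indicator (inRangeᵇ s K w) * f (map (_∸ s) w)) ≡ sumTuples K L f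
sumTuples-shift M s K zero    f _       = *-identityˡ (f [])
sumTuples-shift M s K (suc L) f s+K≤M = begin
  sumBelow (λ x → sumTuples M L (λ w → indicator (inWindowᵇ s K x ∧ inRangeᵇ s K w) * F x w)) M
    ≡⟨ sumBelow-ext M (λ x → trans (sumTuples-cong M L (λ w _ → factor x w)) (sumTuples-*ˡ M L (I x) (G x))) ⟩
  sumBelow (λ x → I x * sumTuples M L (G x)) M
    ≡⟨ sumBelow-ext M (λ x → cong (I x *_) (sumTuples-shift M s K L (f ∘ ((x ∸ s) ∷_)) s+K≤M)) ⟩
  sumBelow (λ x → I x * sumTuples K L (f ∘ ((x ∸ s) ∷_))) M
    ≡⟨ sumBelow-window s K M (λ y → sumTuples K L (f ∘ (y ∷_))) s+K≤M ⟩
  sumTuples K (suc L) f ∎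
  where
  open ≡-Reasoning
  I = λ x → indicator (inWindowᵇ s K x)
  F = λ x w → f ((x ∸ s) ∷ map (_∸ s) w)
  G = λ x w → indicator (inRangeᵇ s K w) * F x w
  factor : ∀ x w → indicator (inWindowᵇ s K x ∧ inRangeᵇ s K w) * F x w ≡ I x * G x w
  factor x w = trans (cong (_* F x w) (indicator-∧ (inWindowᵇ s K x) (inRangeᵇ s K w)))
                     (*-assoc (I x) (indicator (inRangeᵇ s K w)) (F x w))

toℕs : ∀ {m k} → Vec (Fin m) k → List ℕ
toℕs v = map toℕ (toList v)

sum-map-allVecs : ∀ m k (f : List ℕ → ℕ) → sum (map (f ∘ toℕs) (allVecs m k)) ≡ sumTuples m k f
sum-map-allVecs m zero    f = +-identityʳ (f [])
sum-map-allVecs m (suc k) f = begin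
  sum (map (f ∘ toℕs) (concatMap (λ i → map (i ∷_) (allVecs m k)) (allFin m)))
    ≡⟨ sum-map-concatMap (f ∘ toℕs) (λ i → map (i ∷_) (allVecs m k)) (allFin m) ⟩
  sum (map (λ i → sum (map (f ∘ toℕs) (map (i ∷_) (allVecs m k)))) (allFin m))
    ≡⟨ cong sum (map-allFin≡map-upTo m _ (λ x → sumTuples m k (f ∘ (x ∷_))) first) ⟩
  sum (map (λ x → sumTuples m k (f ∘ (x ∷_))) (upTo m))
    ≡⟨ sum-map-applyUpTo (λ x → sumTuples m k (f ∘ (x ∷_))) id m ⟩
  sumTuples m (suc k) f ∎
  where
  open ≡-Reasoning
  first : ∀ i → sum (map (f ∘ toℕs) (map (i ∷_) (allVecs m k))) ≡ sumTuples m k (f ∘ (toℕ i ∷_))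
  first i = trans (cong sum (sym (map-∘ {g = f ∘ toℕs} {f = i ∷_} (allVecs m k)))) (sum-map-allVecs m k (f ∘ (toℕ i ∷_)))

-- The sum over Q(n, k)

[m+n≡ᵇo]≡[n≡ᵇo∸m] : ∀ m n o → m ≤ o → (m + n ≡ᵇ o) ≡ (n ≡ᵇ o ∸ m)
[m+n≡ᵇo]≡[n≡ᵇo∸m] zero    n o       _         = refl
[m+n≡ᵇo]≡[n≡ᵇo∸m] (suc m) n (suc o) (s≤s m≤o) = [m+n≡ᵇo]≡[n≡ᵇo∸m] m n o m≤o

o<m⇒[m+n≡ᵇo]≡false : ∀ m n o → o < m → (m + n ≡ᵇ o) ≡ false
o<m⇒[m+n≡ᵇo]≡false (suc m) n zero    _         = refl
o<m⇒[m+n≡ᵇo]≡false (suc m) n (suc o) (s<s o<m) = o<m⇒[m+n≡ᵇo]≡false m n o o<m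

if-*ˡ : ∀ b c x → (if b then c * x else 0) ≡ c * (if b then x else 0)
if-*ˡ true  c x = refl
if-*ˡ false c x = sym (*-zeroʳ c)

catalanTupleSum : ℕ → ℕ → ℕ → ℕ
catalanTupleSum m k s = sumTuples m k (λ l → if sum l ≡ᵇ s then product (map catalan l) else 0)

catalanSumQ≡catalanTupleSum : ∀ n k → catalanSumQ n k ≡ catalanTupleSum n k (n ∸ k)
catalanSumQ≡catalanTupleSum n k = begin
  sum (map catalanProduct (boolFilter (λ v → vsum v ≡ᵇ (n ∸ k)) (allVecs n k)))
    ≡⟨ sum-map-boolFilter (λ v → vsum v ≡ᵇ (n ∸ k)) catalanProduct (allVecs n k) ⟩
  sum (map (λ v → if vsum v ≡ᵇ (n ∸ k) then catalanProduct v else 0) (allVecs n k))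
    ≡⟨ cong sum (map-cong (λ v → cong (λ p → if vsum v ≡ᵇ (n ∸ k) then p else 0) (cong product (map-∘ (toList v))))
                          (allVecs n k)) ⟩
  sum (map (F ∘ toℕs) (allVecs n k))
    ≡⟨ sum-map-allVecs n k F ⟩
  catalanTupleSum n k (n ∸ k) ∎
  where
  open ≡-Reasoning
  F = λ l → if sum l ≡ᵇ (n ∸ k) then product (map catalan l) else 0

catalanTupleSum-head : ∀ m k s i → i ≤ s →
  sumTuples m k (λ l → if i + sum l ≡ᵇ s then catalan i * product (map catalan l) else 0)
    ≡ catalan i * catalanTupleSum m k (s ∸ i)
catalanTupleSum-head m k s i i≤s =
  trans (sumTuples-cong m k (λ l _ → trans (cong (λ b → if b then catalan i * product (map catalan l) else 0)
                                                  ([m+n≡ᵇo]≡[n≡ᵇo∸m] i (sum l) s i≤s))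
                                            (if-*ˡ (sum l ≡ᵇ s ∸ i) (catalan i) (product (map catalan l)))))
        (sumTuples-*ˡ m k (catalan i) (λ l → if sum l ≡ᵇ s ∸ i then product (map catalan l) else 0))

catalanTupleSum-head-vanishes : ∀ m k s i → s < i →
  sumTuples m k (λ l → if i + sum l ≡ᵇ s then catalan i * product (map catalan l) else 0) ≡ 0
catalanTupleSum-head-vanishes m k s i s<i =
  sumTuples-zero m k (λ l → cong (λ b → if b then catalan i * product (map catalan l) else 0)
                                 (o<m⇒[m+n≡ᵇo]≡false i (sum l) s s<i))

-- The bound m on the entries is no constraint on tuples summing to s < m.
catalanTupleSum≡catalanPower : ∀ m k s → s < m → catalanTupleSum m k s ≡ catalanPower (s + k) k
catalanTupleSum≡catalanPower m zero    zero    _   = refl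
catalanTupleSum≡catalanPower m zero    (suc s) _   = refl
catalanTupleSum≡catalanPower m (suc k) s       s<m = begin
  sumBelow head m
    ≡⟨ cong (sumBelow head) (sym (m+[n∸m]≡n s<m)) ⟩
  sumBelow head (suc s + (m ∸ suc s))
    ≡⟨ sumBelow-+-split head (suc s) (m ∸ suc s) ⟩
  sumBelow head (suc s) + sumBelow (λ i → head (suc s + i)) (m ∸ suc s)
    ≡⟨ cong₂ _+_ (sumBelow-cong (suc s) (λ i i≤s → lowTerm i (≤-pred i≤s)))
                 (sumBelow-zero (m ∸ suc s) (λ i _ → catalanTupleSum-head-vanishes m k s (suc s + i) (s<s (m≤m+n s i)))) ⟩
  sumBelow g (suc s) + 0
    ≡⟨ cong (sumBelow g (suc s) +_) (sym (sumBelow-zero k highTerm)) ⟩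
  sumBelow g (suc s) + sumBelow (λ i → g (suc s + i)) k
    ≡⟨ sym (sumBelow-+-split g (suc s) k) ⟩
  sumBelow g (suc (s + k))
    ≡⟨ cong (λ n → catalanPower n (suc k)) (sym (+-suc s k)) ⟩
  catalanPower (s + suc k) (suc k) ∎
  where
  open ≡-Reasoning
  head = λ i → sumTuples m k (λ l → if i + sum l ≡ᵇ s then catalan i * product (map catalan l) else 0)
  g = λ i → catalan i * catalanPower ((s + k) ∸ i) k
  lowTerm : ∀ i → i ≤ s → head i ≡ g i
  lowTerm i i≤s = begin
    head i                                   ≡⟨ catalanTupleSum-head m k s i i≤s ⟩
    catalan i * catalanTupleSum m k (s ∸ i)  ≡⟨ cong (catalan i *_) (catalanTupleSum≡catalanPower m k (s ∸ i) (≤-<-trans (m∸n≤m s i) s<m)) ⟩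
    catalan i * catalanPower (s ∸ i + k) k   ≡⟨ cong (λ n → catalan i * catalanPower n k) (sym (+-∸-comm k i≤s)) ⟩
    g i                                      ∎
  highTerm : ∀ j → j < k → g (suc s + j) ≡ 0
  highTerm j j<k = trans (cong (catalan (suc s + j) *_) (catalanPower-vanishes _ k below)) (*-zeroʳ (catalan (suc s + j)))
    where
    below : (s + k) ∸ (suc s + j) < k
    below = subst (_< k) (trans (sym ([m+n]∸[m+o]≡n∸o s k (suc j))) (cong (s + k ∸_) (+-suc s j)))
                  (∸-monoʳ-< {o = 0} z<s j<k)

catalanSumQ≡catalanPower : ∀ n k → 1 ≤ k → k ≤ n → catalanSumQ n k ≡ catalanPower n k
catalanSumQ≡catalanPower n k 1≤k k≤n = begin
  catalanSumQ n k                       ≡⟨ catalanSumQ≡catalanTupleSum n k ⟩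
  catalanTupleSum n k (n ∸ k)           ≡⟨ catalanTupleSum≡catalanPower n k (n ∸ k) (∸-monoʳ-< {o = 0} 1≤k k≤n) ⟩
  catalanPower (n ∸ k + k) k            ≡⟨ cong (λ m → catalanPower m k) (m∸n+n≡m k≤n) ⟩
  catalanPower n k                      ∎
  where open ≡-Reasoning

-- Non-crossing matchings of the positions 0, …, N-1, given by their partner functions

isFPFInvolutionᵇ : ℕ → (ℕ → ℕ) → Bool
isFPFInvolutionᵇ N g = all (λ i → (g (g i) ≡ᵇ i) ∧ not (g i ≡ᵇ i)) (upTo N)

isNonCrossingᵇ : ℕ → (ℕ → ℕ) → Bool
isNonCrossingᵇ N g = all (λ a → all (λ b → not ((a <ᵇ b) ∧ (b <ᵇ g a) ∧ (g a <ᵇ g b))) (upTo N)) (upTo N)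

isNCMatchingᵇ : ℕ → (ℕ → ℕ) → Bool
isNCMatchingᵇ N g = isFPFInvolutionᵇ N g ∧ isNonCrossingᵇ N g

isExposedᵇ : ℕ → (ℕ → ℕ) → ℕ → Bool
isExposedᵇ N g a = (a <ᵇ g a) ∧ not (any (λ c → (c <ᵇ a) ∧ (g a <ᵇ g c)) (upTo N))

exposedCount : ℕ → (ℕ → ℕ) → ℕ
exposedCount N g = sumBelow (indicator ∘ isExposedᵇ N g) N

exposedCount-≗ : ∀ N {g h : ℕ → ℕ} → (∀ i → g i ≡ h i) → exposedCount N g ≡ exposedCount N h
exposedCount-≗ N g≗h = sumBelow-ext N (λ a → cong indicator (cong₂ _∧_ (cong (a <ᵇ_) (g≗h a))
  (cong not (cong or (map-cong (λ c → cong ((c <ᵇ a) ∧_) (cong₂ _<ᵇ_ (g≗h a) (g≗h c))) (upTo N))))))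

isNCMatchingWithᵇ : ℕ → ℕ → List ℕ → Bool
isNCMatchingWithᵇ N k l = isNCMatchingᵇ N (nth l) ∧ (exposedCount N (nth l) ≡ᵇ k)

ncMatchingCount : ℕ → ℕ → ℕ
ncMatchingCount N k = sumTuples N N (indicator ∘ isNCMatchingWithᵇ N k)

ncMatchingTotal : ℕ → ℕ
ncMatchingTotal N = sumTuples N N (λ l → indicator (isNCMatchingᵇ N (nth l)))

toℕ-lookup≡nth-toℕs : ∀ {m L} (v : Vec (Fin m) L) (i : Fin L) → toℕ (lookup v i) ≡ nth (toℕs v) (toℕ i)
toℕ-lookup≡nth-toℕs (x ∷ v) fzero    = refl
toℕ-lookup≡nth-toℕs (x ∷ v) (fsuc i) = toℕ-lookup≡nth-toℕs v i

⌊≟⌋≡toℕ-≡ᵇ : ∀ {m} (x y : Fin m) → ⌊ x Fin.≟ y ⌋ ≡ (toℕ x ≡ᵇ toℕ y)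
⌊≟⌋≡toℕ-≡ᵇ x y with x Fin.≟ y
... | yes refl = T-⇔⇒≡ (λ _ → ≡⇒≡ᵇ (toℕ x) (toℕ x) refl) (λ _ → _)
... | no  x≢y  = T-⇔⇒≡ (λ ()) (λ t → x≢y (Fin.toℕ-injective (≡ᵇ⇒≡ (toℕ x) (toℕ y) t)))

module _ {n : ℕ} (f : Matching n) where

  private
    N = n + n
    g = nth (toℕs f)
    partner≡g : ∀ i → partner {n} f i ≡ g (toℕ i)
    partner≡g = toℕ-lookup≡nth-toℕs f

  isTL≡isNCMatchingᵇ : isTL {n} f ≡ isNCMatchingᵇ (n + n) (nth (toℕs f))
  isTL≡isNCMatchingᵇ = cong₂ _∧_
    (cong and (map-allFin≡map-upTo N _ _ (λ i → cong₂ _∧_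
      (trans (⌊≟⌋≡toℕ-≡ᵇ (lookup f (lookup f i)) i)
             (cong (_≡ᵇ toℕ i) (trans (partner≡g (lookup f i)) (cong g (partner≡g i)))))
      (cong not (trans (⌊≟⌋≡toℕ-≡ᵇ (lookup f i) i) (cong (_≡ᵇ toℕ i) (partner≡g i)))))))
    (cong and (map-allFin≡map-upTo N _ _ (λ a → cong and (map-allFin≡map-upTo N _ _ (λ b →
      cong (λ x → not ((toℕ a <ᵇ toℕ b) ∧ x))
           (cong₂ _∧_ (cong (toℕ b <ᵇ_) (partner≡g a)) (cong₂ _<ᵇ_ (partner≡g a) (partner≡g b))))))))

  exposedArcs≡exposedCount : exposedArcs {n} f ≡ exposedCount (n + n) (nth (toℕs f))
  exposedArcs≡exposedCount = begin
    countTrue (isExposedArcLeftEnd {n} f) (allFin N)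
      ≡⟨ countTrue≡sum-map-indicator (isExposedArcLeftEnd {n} f) (allFin N) ⟩
    sum (map (indicator ∘ isExposedArcLeftEnd {n} f) (allFin N))
      ≡⟨ cong sum (map-allFin≡map-upTo N _ (indicator ∘ isExposedᵇ N g) (λ a → cong indicator (cong₂ _∧_
           (cong (toℕ a <ᵇ_) (partner≡g a))
           (cong not (cong or (map-allFin≡map-upTo N _ _ (λ c → cong ((toℕ c <ᵇ toℕ a) ∧_) (cong₂ _<ᵇ_ (partner≡g a) (partner≡g c))))))))) ⟩
    sum (map (indicator ∘ isExposedᵇ N g) (upTo N))
      ≡⟨ sum-map-applyUpTo (indicator ∘ isExposedᵇ N g) id N ⟩
    exposedCount N g ∎
    where open ≡-Reasoning

chi≡ncMatchingCount : ∀ n k → chi n k ≡ ncMatchingCount (n + n) k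
chi≡ncMatchingCount n k = begin
  countTrue P (allVecs N N)               ≡⟨ countTrue≡sum-map-indicator P (allVecs N N) ⟩
  sum (map (indicator ∘ P) (allVecs N N)) ≡⟨ cong sum (map-cong P≡F (allVecs N N)) ⟩
  sum (map (F ∘ toℕs) (allVecs N N))      ≡⟨ sum-map-allVecs N N F ⟩
  ncMatchingCount N k                     ∎
  where
  open ≡-Reasoning
  N = n + n
  P = λ (f : Matching n) → isTL {n} f ∧ (exposedArcs {n} f ≡ᵇ k)
  F = λ l → indicator (isNCMatchingᵇ N (nth l) ∧ (exposedCount N (nth l) ≡ᵇ k))
  P≡F : ∀ f → indicator (P f) ≡ F (toℕs f)
  P≡F f = cong indicator (cong₂ _∧_ (isTL≡isNCMatchingᵇ {n} f) (cong (_≡ᵇ k) (exposedArcs≡exposedCount {n} f)))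

record IsNCMatching (N : ℕ) (g : ℕ → ℕ) : Set where
  field
    involutive     : ∀ i → i < N → g (g i) ≡ i
    fixedPointFree : ∀ i → i < N → g i ≢ i
    nonCrossing    : ∀ a b → a < N → b < N → a < b → b < g a → g a < g b → ⊥

IsNCMatching-≗ : ∀ {N} {g h : ℕ → ℕ} → (∀ i → g i ≡ h i) → IsNCMatching N g → IsNCMatching N h
IsNCMatching-≗ {N} {g} {h} g≗h m = record
  { involutive     = λ i i<N → trans (sym (trans (g≗h (g i)) (cong h (g≗h i)))) (involutive i i<N)
  ; fixedPointFree = λ i i<N hi≡i → fixedPointFree i i<N (trans (g≗h i) hi≡i)
  ; nonCrossing    = λ a b a<N b<N a<b b<ha ha<hb →
      nonCrossing a b a<N b<N a<b (subst (b <_) (sym (g≗h a)) b<ha) (subst₂ _<_ (sym (g≗h a)) (sym (g≗h b)) ha<hb)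
  }
  where open IsNCMatching m

Enclosed : ℕ → (ℕ → ℕ) → ℕ → Set
Enclosed N g a = ∃[ c ] (c < N × c < a × g a < g c)

IsNCMatching-restrict : ∀ {M L} {g h : ℕ → ℕ} a → a + L ≤ M →
  (∀ x → x < L → h x < L) → (∀ x → x < L → a + h x ≡ g (a + x)) →
  IsNCMatching M g → IsNCMatching L h
IsNCMatching-restrict {M} {L} {g} {h} a a+L≤M h<L a+h≡g m = record
  { involutive     = λ x x<L → +-cancelˡ-≡ a (h (h x)) x
      (trans (a+h≡g (h x) (h<L x x<L)) (trans (cong g (a+h≡g x x<L)) (involutive (a + x) (shift< x<L))))
  ; fixedPointFree = λ x x<L hx≡x →
      fixedPointFree (a + x) (shift< x<L) (trans (sym (a+h≡g x x<L)) (cong (a +_) hx≡x))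
  ; nonCrossing    = λ x y x<L y<L x<y y<hx hx<hy →
      nonCrossing (a + x) (a + y) (shift< x<L) (shift< y<L) (+-monoʳ-< a x<y)
        (subst (a + y <_) (a+h≡g x x<L) (+-monoʳ-< a y<hx))
        (subst₂ _<_ (a+h≡g x x<L) (a+h≡g y y<L) (+-monoʳ-< a hx<hy))
  }
  where
  open IsNCMatching m
  shift< : ∀ {x} → x < L → a + x < M
  shift< x<L = <-≤-trans (+-monoʳ-< a x<L) a+L≤M

T-not⇒¬T : ∀ {b} → T (not b) → ¬ T b
T-not⇒¬T {false} _ ()

¬T⇒T-not : ∀ {b} → ¬ T b → T (not b)
¬T⇒T-not {false} _  = _
¬T⇒T-not {true}  ¬b = ¬b _

all-upTo⁻ : ∀ {p : ℕ → Bool} N → T (all p (upTo N)) → ∀ i → i < N → T (p i)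
all-upTo⁻ {p} N t i i<N = All.applyUpTo⁻ id N (All.all⁺ p (upTo N) t) i<N

all-upTo⁺ : ∀ {p : ℕ → Bool} N → (∀ i → i < N → T (p i)) → T (all p (upTo N))
all-upTo⁺ {p} N ps = All.all⁻ p (All.applyUpTo⁺₁ id N (ps _))

any-upTo⁻ : ∀ {p : ℕ → Bool} N → T (any p (upTo N)) → ∃[ i ] (i < N × T (p i))
any-upTo⁻ {p} N t = Any.applyUpTo⁻ id (Any.any⁻ p (upTo N) t)

any-upTo⁺ : ∀ {p : ℕ → Bool} N i → i < N → T (p i) → T (any p (upTo N))
any-upTo⁺ {p} N i i<N pi = Any.any⁺ p (Any.applyUpTo⁺ id pi i<N)

isNCMatchingᵇ⇒IsNCMatching : ∀ N g → T (isNCMatchingᵇ N g) → IsNCMatching N g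
isNCMatchingᵇ⇒IsNCMatching N g t = record
  { involutive     = λ i i<N → ≡ᵇ⇒≡ _ i (proj₁ (to T-∧ (fpf i i<N)))
  ; fixedPointFree = λ i i<N gi≡i → T-not⇒¬T (proj₂ (to (T-∧ {g (g i) ≡ᵇ i}) (fpf i i<N))) (≡⇒≡ᵇ _ i gi≡i)
  ; nonCrossing    = λ a b a<N b<N a<b b<ga ga<gb →
      T-not⇒¬T (all-upTo⁻ N (all-upTo⁻ N (proj₂ (to T-∧ t)) a a<N) b b<N)
               (from T-∧ (<⇒<ᵇ a<b , from T-∧ (<⇒<ᵇ b<ga , <⇒<ᵇ ga<gb)))
  }
  where
  fpf = all-upTo⁻ N (proj₁ (to (T-∧ {isFPFInvolutionᵇ N g}) t))

IsNCMatching⇒isNCMatchingᵇ : ∀ N g → IsNCMatching N g → T (isNCMatchingᵇ N g)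
IsNCMatching⇒isNCMatchingᵇ N g m = from T-∧
  ( all-upTo⁺ N (λ i i<N → from T-∧ (≡⇒≡ᵇ _ i (involutive i i<N) ,
                                      ¬T⇒T-not (λ t → fixedPointFree i i<N (≡ᵇ⇒≡ _ i t))))
  , all-upTo⁺ N (λ a a<N → all-upTo⁺ N (λ b b<N → ¬T⇒T-not (λ t →
      let (a<b , t′) = to T-∧ t ; (b<ga , ga<gb) = to T-∧ t′ in
      nonCrossing a b a<N b<N (<ᵇ⇒< a b a<b) (<ᵇ⇒< b _ b<ga) (<ᵇ⇒< _ _ ga<gb)))))
  where open IsNCMatching m

isExposedᵇ⇒ : ∀ N g a → T (isExposedᵇ N g a) → a < g a × ¬ Enclosed N g a
isExposedᵇ⇒ N g a t =
  <ᵇ⇒< a (g a) a<ga ,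
  λ (c , c<N , c<a , ga<gc) → T-not⇒¬T unenclosed (any-upTo⁺ N c c<N (from T-∧ (<⇒<ᵇ c<a , <⇒<ᵇ ga<gc)))
  where
  a<ga = proj₁ (to T-∧ t)
  unenclosed = proj₂ (to (T-∧ {a <ᵇ g a}) t)

isExposedᵇ⇐ : ∀ N g a → a < g a → ¬ Enclosed N g a → T (isExposedᵇ N g a)
isExposedᵇ⇐ N g a a<ga unenclosed = from T-∧ (<⇒<ᵇ a<ga , ¬T⇒T-not λ t →
  let (c , c<N , q) = any-upTo⁻ N t ; (c<a , ga<gc) = to T-∧ q in
  unenclosed (c , c<N , <ᵇ⇒< c a c<a , <ᵇ⇒< (g a) (g c) ga<gc))

-- Cutting a matching of 2 + p + r positions along its first arc {0, 1 + p}

module FirstArc (p r z : ℕ) (U V g : ℕ → ℕ)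
  (g[0]≡1+p : g 0 ≡ suc p) (g-inside : ∀ i → i < p → g (suc i) ≡ U i) (g[1+p]≡z : g (suc p) ≡ z)
  (g-outside : ∀ j → g (2 + p + j) ≡ V j) (V<M : ∀ j → j < r → V j < 2 + p + r) where

  -- U and V are g on the positions under the arc and after it; inner and outer are the
  -- matchings they induce on 0, …, p-1 and on 0, …, r-1.

  s : ℕ
  s = 2 + p

  M : ℕ
  M = s + r

  inner : ℕ → ℕ
  inner i = U i ∸ 1

  outer : ℕ → ℕ
  outer j = V j ∸ s

  InnerInRange : Set
  InnerInRange = ∀ i → i < p → 1 ≤ U i × U i < suc p

  OuterInRange : Set
  OuterInRange = ∀ j → j < r → s ≤ V j

  data Position (a : ℕ) : Set where
    opening : a ≡ 0 → Position a
    inside  : ∀ i → i < p → a ≡ suc i → Position a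
    closing : a ≡ suc p → Position a
    outside : ∀ j → a ≡ s + j → Position a

  position : ∀ a → Position a
  position zero = opening refl
  position (suc a) with <-cmp a p
  ... | tri< a<p _ _  = inside a a<p refl
  ... | tri≈ _ refl _ = closing refl
  ... | tri> _ _ p<a  = outside (a ∸ suc p) (cong suc (sym (m+[n∸m]≡n p<a)))

  0<M : 0 < M
  0<M = z<s

  1+p<M : suc p < M
  1+p<M = s<s (s<s (m≤m+n p r))

  inside<M : ∀ {i} → i < p → suc i < M
  inside<M i<p = <-trans (s<s i<p) 1+p<M

  outside<M : ∀ {j} → j < r → s + j < M
  outside<M = +-monoʳ-< s

  outside<M⇒<r : ∀ {j} → s + j < M → j < r
  outside<M⇒<r {j} = +-cancelˡ-< s j r

  1+p<outside : ∀ j → suc p < s + j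
  1+p<outside j = s<s (s<s (m≤m+n p j))

  p<outside : ∀ j → p < s + j
  p<outside j = <-trans (n<1+n p) (1+p<outside j)

  module InnerShift (inRange : InnerInRange) where

    suc-inner : ∀ i → i < p → suc (inner i) ≡ g (suc i)
    suc-inner i i<p = trans (m+[n∸m]≡n (proj₁ (inRange i i<p))) (sym (g-inside i i<p))

    inner<p : ∀ i → i < p → inner i < p
    inner<p i i<p = ≤-pred (subst (_< suc p) (sym (m+[n∸m]≡n (proj₁ (inRange i i<p)))) (proj₂ (inRange i i<p)))

    g-inside≤p : ∀ i → i < p → g (suc i) ≤ p
    g-inside≤p i i<p = subst (_≤ p) (suc-inner i i<p) (inner<p i i<p)

  module OuterShift (inRange : OuterInRange) where

    s+outer : ∀ j → j < r → s + outer j ≡ g (s + j)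
    s+outer j j<r = trans (m+[n∸m]≡n (inRange j j<r)) (sym (g-outside j))

    outer<r : ∀ j → j < r → outer j < r
    outer<r j j<r = +-cancelˡ-< s (outer j) r (subst (_< M) (sym (m+[n∸m]≡n (inRange j j<r))) (V<M j j<r))

  module FromMatching (m : IsNCMatching M g) where
    open IsNCMatching m

    z≡0 : z ≡ 0
    z≡0 = trans (sym g[1+p]≡z) (trans (cong g (sym g[0]≡1+p)) (involutive 0 0<M))

    g[U]≡1+i : ∀ i → i < p → g (U i) ≡ suc i
    g[U]≡1+i i i<p = trans (cong g (sym (g-inside i i<p))) (involutive (suc i) (inside<M i<p))

    g[V]≡s+j : ∀ j → j < r → g (V j) ≡ s + j
    g[V]≡s+j j j<r = trans (cong g (sym (g-outside j))) (involutive (s + j) (outside<M j<r))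

    innerInRange : InnerInRange
    innerInRange i i<p = n≢0⇒n>0 U≢0 , ≤∧≢⇒< (≮⇒≥ crossing) U≢1+p
      where
      U≢0 : U i ≢ 0
      U≢0 U≡0 = <-irrefl (suc-injective (trans (sym (g[U]≡1+i i i<p)) (trans (cong g U≡0) g[0]≡1+p))) i<p
      U≢1+p : U i ≢ suc p
      U≢1+p U≡1+p = 1+n≢0 (trans (sym (g[U]≡1+i i i<p)) (trans (cong g U≡1+p) (trans g[1+p]≡z z≡0)))
      crossing : ¬ (suc p < U i)
      crossing 1+p<U = nonCrossing 0 (suc i) 0<M (inside<M i<p) z<s
        (subst (suc i <_) (sym g[0]≡1+p) (s<s i<p)) (subst₂ _<_ (sym g[0]≡1+p) (sym (g-inside i i<p)) 1+p<U)

    outerInRange : OuterInRange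
    outerInRange j j<r with position (V j)
    ... | opening V≡0 = ⊥-elim (<-irrefl (trans (sym g[0]≡1+p) (trans (cong g (sym V≡0)) (g[V]≡s+j j j<r))) (1+p<outside j))
    ... | inside i i<p V≡1+i = ⊥-elim (<⇒≱ (p<outside j)
            (subst (_≤ p) (trans (cong g (sym V≡1+i)) (g[V]≡s+j j j<r)) (InnerShift.g-inside≤p innerInRange i i<p)))
    ... | closing V≡1+p = ⊥-elim (1+n≢0 (trans (sym (g[V]≡s+j j j<r)) (trans (cong g V≡1+p) (trans g[1+p]≡z z≡0))))
    ... | outside j′ V≡s+j′ = subst (s ≤_) (sym V≡s+j′) (m≤m+n s j′)

    innerMatching : IsNCMatching p inner
    innerMatching = IsNCMatching-restrict 1 (<⇒≤ 1+p<M) inner<p suc-inner m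
      where open InnerShift innerInRange

    outerMatching : IsNCMatching r outer
    outerMatching = IsNCMatching-restrict s ≤-refl outer<r s+outer m
      where open OuterShift outerInRange

  module ToMatching (z≡0 : z ≡ 0) (innerRange : InnerInRange) (innerMatching : IsNCMatching p inner)
                    (outerRange : OuterInRange) (outerMatching : IsNCMatching r outer) where
    open InnerShift innerRange
    open OuterShift outerRange
    private
      module I = IsNCMatching innerMatching
      module O = IsNCMatching outerMatching

    g[1+p]≡0 : g (suc p) ≡ 0
    g[1+p]≡0 = trans g[1+p]≡z z≡0

    involutive : ∀ a → a < M → g (g a) ≡ a
    involutive a a<M with position a
    ... | opening refl      = trans (cong g g[0]≡1+p) g[1+p]≡0
    ... | inside i i<p refl = trans (cong g (sym (suc-inner i i<p)))
                                    (trans (sym (suc-inner (inner i) (inner<p i i<p))) (cong suc (I.involutive i i<p)))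
    ... | closing refl      = trans (cong g g[1+p]≡0) g[0]≡1+p
    ... | outside j refl    = trans (cong g (sym (s+outer j j<r)))
                                    (trans (sym (s+outer (outer j) (outer<r j j<r))) (cong (s +_) (O.involutive j j<r)))
      where j<r = outside<M⇒<r a<M

    fixedPointFree : ∀ a → a < M → g a ≢ a
    fixedPointFree a a<M ga≡a with position a
    ... | opening refl      = 1+n≢0 (trans (sym g[0]≡1+p) ga≡a)
    ... | inside i i<p refl = I.fixedPointFree i i<p (suc-injective (trans (suc-inner i i<p) ga≡a))
    ... | closing refl      = 1+n≢0 (sym (trans (sym g[1+p]≡0) ga≡a))
    ... | outside j refl    = O.fixedPointFree j j<r (+-cancelˡ-≡ s _ _ (trans (s+outer j j<r) ga≡a))
      where j<r = outside<M⇒<r a<M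

    noCrossing-opening : ∀ b → 0 < b → b < g 0 → g 0 < g b → ⊥
    noCrossing-opening (suc b) _ b<g0 g0<gb =
      <⇒≱ (subst₂ _<_ g[0]≡1+p (sym (suc-inner b b<p)) g0<gb) (s≤s (<⇒≤ (inner<p b b<p)))
      where b<p = ≤-pred (subst (suc b <_) g[0]≡1+p b<g0)

    noCrossing-inside : ∀ i b → i < p → suc i < b → b < g (suc i) → g (suc i) < g b → ⊥
    noCrossing-inside i (suc b) i<p a<b b<ga ga<gb =
      I.nonCrossing i b i<p b<p (≤-pred a<b) b<inner
        (≤-pred (subst₂ _<_ (sym (suc-inner i i<p)) (sym (suc-inner b b<p)) ga<gb))
      where
      b<inner = ≤-pred (subst (suc b <_) (sym (suc-inner i i<p)) b<ga)
      b<p = <-trans b<inner (inner<p i i<p)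

    noCrossing-outside : ∀ j b → j < r → b < M → s + j < b → b < g (s + j) → g (s + j) < g b → ⊥
    noCrossing-outside j b j<r b<M a<b b<ga ga<gb with position b
    ... | opening refl       = <⇒≱ a<b z≤n
    ... | inside i i<p refl  = <⇒≱ (<-trans a<b (s<s i<p)) (<⇒≤ (1+p<outside j))
    ... | closing refl       = <-asym a<b (1+p<outside j)
    ... | outside j′ refl    =
      O.nonCrossing j j′ j<r j′<r (+-cancelˡ-< s j j′ a<b)
        (+-cancelˡ-< s j′ (outer j) (subst (s + j′ <_) (sym (s+outer j j<r)) b<ga))
        (+-cancelˡ-< s (outer j) (outer j′) (subst₂ _<_ (sym (s+outer j j<r)) (sym (s+outer j′ j′<r)) ga<gb))
      where j′<r = outside<M⇒<r b<M

    nonCrossing : ∀ a b → a < M → b < M → a < b → b < g a → g a < g b → ⊥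
    nonCrossing a b a<M b<M a<b b<ga ga<gb with position a
    ... | opening refl      = noCrossing-opening b a<b b<ga ga<gb
    ... | inside i i<p refl = noCrossing-inside i b i<p a<b b<ga ga<gb
    ... | closing refl      = <⇒≱ (<-trans a<b (subst (b <_) g[1+p]≡0 b<ga)) z≤n
    ... | outside j refl    = noCrossing-outside j b (outside<M⇒<r a<M) b<M a<b b<ga ga<gb

    matching : IsNCMatching M g
    matching = record { involutive = involutive ; fixedPointFree = fixedPointFree ; nonCrossing = nonCrossing }

  module Exposure (z≡0 : z ≡ 0) (innerRange : InnerInRange) (outerRange : OuterInRange) where
    open InnerShift innerRange
    open OuterShift outerRange

    exposed : ℕ → ℕ
    exposed a = indicator (isExposedᵇ M g a)

    opening-exposed : exposed 0 ≡ 1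
    opening-exposed = T⇒indicator≡1 (isExposedᵇ⇐ M g 0 (subst (0 <_) (sym g[0]≡1+p) z<s) λ { (c , _ , () , _) })

    inside-unexposed : ∀ i → i < p → exposed (suc i) ≡ 0
    inside-unexposed i i<p = ¬T⇒indicator≡0 λ t → proj₂ (isExposedᵇ⇒ M g (suc i) t)
      (0 , 0<M , z<s , subst (g (suc i) <_) (sym g[0]≡1+p) (s<s (g-inside≤p i i<p)))

    closing-unexposed : exposed (suc p) ≡ 0
    closing-unexposed = ¬T⇒indicator≡0 λ t →
      <⇒≱ (subst (suc p <_) (trans g[1+p]≡z z≡0) (proj₁ (isExposedᵇ⇒ M g (suc p) t))) z≤n

    enclosed-outer⇒enclosed : ∀ j → j < r → Enclosed r outer j → Enclosed M g (s + j)
    enclosed-outer⇒enclosed j j<r (c , c<r , c<j , oj<oc) =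
      s + c , outside<M c<r , +-monoʳ-< s c<j , subst₂ _<_ (s+outer j j<r) (s+outer c c<r) (+-monoʳ-< s oj<oc)

    1+p<g[s+j] : ∀ j → j < r → suc p < g (s + j)
    1+p<g[s+j] j j<r = subst (suc p <_) (s+outer j j<r) (1+p<outside (outer j))

    enclosed⇒enclosed-outer : ∀ j → j < r → Enclosed M g (s + j) → Enclosed r outer j
    enclosed⇒enclosed-outer j j<r (c , c<M , c<a , ga<gc) with position c
    ... | opening refl      = ⊥-elim (<-asym (1+p<g[s+j] j j<r) (subst (g (s + j) <_) g[0]≡1+p ga<gc))
    ... | inside i i<p refl = ⊥-elim (<⇒≱ (<-trans (s≤s (g-inside≤p i i<p)) (1+p<g[s+j] j j<r)) (<⇒≤ ga<gc))
    ... | closing refl      = ⊥-elim (<⇒≱ (subst (g (s + j) <_) (trans g[1+p]≡z z≡0) ga<gc) z≤n)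
    ... | outside c′ refl   = c′ , c′<r , +-cancelˡ-< s c′ j c<a ,
        +-cancelˡ-< s (outer j) (outer c′) (subst₂ _<_ (sym (s+outer j j<r)) (sym (s+outer c′ c′<r)) ga<gc)
      where c′<r = outside<M⇒<r c<M

    outside-exposed : ∀ j → j < r → exposed (s + j) ≡ indicator (isExposedᵇ r outer j)
    outside-exposed j j<r = cong indicator (T-⇔⇒≡ restrict extend)
      where
      restrict : T (isExposedᵇ M g (s + j)) → T (isExposedᵇ r outer j)
      restrict t = isExposedᵇ⇐ r outer j
        (+-cancelˡ-< s j (outer j) (subst (s + j <_) (sym (s+outer j j<r)) (proj₁ (isExposedᵇ⇒ M g (s + j) t))))
        (proj₂ (isExposedᵇ⇒ M g (s + j) t) ∘ enclosed-outer⇒enclosed j j<r)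
      extend : T (isExposedᵇ r outer j) → T (isExposedᵇ M g (s + j))
      extend t = isExposedᵇ⇐ M g (s + j)
        (subst (s + j <_) (s+outer j j<r) (+-monoʳ-< s (proj₁ (isExposedᵇ⇒ r outer j t))))
        (proj₂ (isExposedᵇ⇒ r outer j t) ∘ enclosed⇒enclosed-outer j j<r)

    exposedCount≡1+exposedCount-outer : exposedCount M g ≡ suc (exposedCount r outer)
    exposedCount≡1+exposedCount-outer = begin
      sumBelow exposed (s + r)
        ≡⟨ sumBelow-+-split exposed s r ⟩
      sumBelow exposed s + sumBelow (λ j → exposed (s + j)) r
        ≡⟨ cong₂ _+_ firstArc (sumBelow-cong r outside-exposed) ⟩
      1 + exposedCount r outer ∎
      where
      open ≡-Reasoning
      firstArc : sumBelow exposed s ≡ 1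
      firstArc = begin
        exposed 0 + sumBelow (exposed ∘ suc) (suc p)         ≡⟨ cong (exposed 0 +_) (sumBelow-sucʳ (exposed ∘ suc) p) ⟩
        exposed 0 + (sumBelow (exposed ∘ suc) p + exposed (suc p))
          ≡⟨ cong₂ _+_ opening-exposed (cong₂ _+_ (sumBelow-zero p inside-unexposed) closing-unexposed) ⟩
        1 ∎

-- A tuple with first entry 1 + p is split as 1 + p ∷ u ++ z ∷ v, where u lists the partners of
-- the positions under the first arc and z that of its closing position.

innerOkᵇ : ℕ → List ℕ → Bool
innerOkᵇ p u = inRangeᵇ 1 p u ∧ isNCMatchingᵇ p (nth (map (_∸ 1) u))

outerOkᵇ : ℕ → ℕ → ℕ → List ℕ → Bool
outerOkᵇ p r k v = inRangeᵇ (2 + p) r v ∧ isNCMatchingWithᵇ r k (map (_∸ (2 + p)) v)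

module _ (p r k : ℕ) (u : List ℕ) (z : ℕ) (v : List ℕ) (len-u : length u ≡ p) (len-v : length v ≡ r)
         (v<M′ : ∀ j → j < r → nth v j < suc (p + suc r)) where

  private
    g = nth (suc p ∷ u ++ z ∷ v)

    g-inside : ∀ i → i < p → g (suc i) ≡ nth u i
    g-inside i i<p = nth-++ˡ u (z ∷ v) i (subst (i <_) (sym len-u) i<p)

    g[1+p]≡z : g (suc p) ≡ z
    g[1+p]≡z = trans (cong (nth (u ++ z ∷ v)) (sym (trans (+-identityʳ (length u)) len-u))) (nth-++ʳ u (z ∷ v) 0)

    g-outside : ∀ j → g (2 + p + j) ≡ nth v j
    g-outside j = trans (cong (nth (u ++ z ∷ v)) (sym (trans (cong (_+ suc j) len-u) (+-suc p j))))
                        (nth-++ʳ u (z ∷ v) (suc j))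

    v<M : ∀ j → j < r → nth v j < 2 + p + r
    v<M j j<r = subst (nth v j <_) (cong suc (+-suc p r)) (v<M′ j j<r)

    open FirstArc p r z (nth u) (nth v) g refl g-inside g[1+p]≡z g-outside v<M

    inner≗ : ∀ i → inner i ≡ nth (map (_∸ 1) u) i
    inner≗ i = sym (nth-map-∸ 1 u i)

    outer≗ : ∀ j → outer j ≡ nth (map (_∸ s) v) j
    outer≗ j = sym (nth-map-∸ s v j)

  cut-firstArc : T (isNCMatchingWithᵇ (2 + p + r) (suc k) (suc p ∷ u ++ z ∷ v)) →
                 T (innerOkᵇ p u ∧ ((z ≡ᵇ 0) ∧ outerOkᵇ p r k v))
  cut-firstArc t = from T-∧
    ( from T-∧ ( inRangeᵇ⇐ 1 p u (λ i i<u → innerInRange i (subst (i <_) len-u i<u))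
               , IsNCMatching⇒isNCMatchingᵇ p _ (IsNCMatching-≗ inner≗ innerMatching) )
    , from T-∧ ( ≡⇒≡ᵇ z 0 z≡0
               , from T-∧ ( inRangeᵇ⇐ s r v (λ j j<v → let j<r = subst (j <_) len-v j<v in outerInRange j j<r , v<M j j<r)
                          , from T-∧ ( IsNCMatching⇒isNCMatchingᵇ r _ (IsNCMatching-≗ outer≗ outerMatching)
                                     , ≡⇒≡ᵇ _ k outerExposed ) ) ) )
    where
    open FromMatching (isNCMatchingᵇ⇒IsNCMatching M g (proj₁ (to T-∧ t)))
    outerExposed : exposedCount r (nth (map (_∸ s) v)) ≡ k
    outerExposed = trans (sym (exposedCount-≗ r outer≗)) (suc-injective (trans
      (sym (Exposure.exposedCount≡1+exposedCount-outer z≡0 innerInRange outerInRange))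
      (≡ᵇ⇒≡ _ (suc k) (proj₂ (to (T-∧ {isNCMatchingᵇ M g}) t)))))

  glue-firstArc : T (innerOkᵇ p u ∧ ((z ≡ᵇ 0) ∧ outerOkᵇ p r k v)) →
                  T (isNCMatchingWithᵇ (2 + p + r) (suc k) (suc p ∷ u ++ z ∷ v))
  glue-firstArc t = from T-∧
    ( IsNCMatching⇒isNCMatchingᵇ M g (ToMatching.matching z≡0 innerRange innerMatching outerRange outerMatching)
    , ≡⇒≡ᵇ _ (suc k) (trans (Exposure.exposedCount≡1+exposedCount-outer z≡0 innerRange outerRange)
                             (cong suc (trans (exposedCount-≗ r outer≗) (≡ᵇ⇒≡ _ k tOk)))) )
    where
    tI  = proj₁ (to T-∧ t)
    tZO = proj₂ (to (T-∧ {innerOkᵇ p u}) t)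
    tO  = proj₂ (to (T-∧ {z ≡ᵇ 0}) tZO)
    tOm = proj₂ (to (T-∧ {inRangeᵇ s r v}) tO)
    tOk = proj₂ (to (T-∧ {isNCMatchingᵇ r (nth (map (_∸ s) v))}) tOm)
    z≡0 : z ≡ 0
    z≡0 = ≡ᵇ⇒≡ z 0 (proj₁ (to T-∧ tZO))
    innerRange : InnerInRange
    innerRange i i<p = inRangeᵇ⇒ 1 p u (proj₁ (to T-∧ tI)) i (subst (i <_) (sym len-u) i<p)
    outerRange : OuterInRange
    outerRange j j<r = proj₁ (inRangeᵇ⇒ s r v (proj₁ (to T-∧ tO)) j (subst (j <_) (sym len-v) j<r))
    innerMatching : IsNCMatching p inner
    innerMatching = IsNCMatching-≗ (sym ∘ inner≗) (isNCMatchingᵇ⇒IsNCMatching p _ (proj₂ (to (T-∧ {inRangeᵇ 1 p u}) tI)))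
    outerMatching : IsNCMatching r outer
    outerMatching = IsNCMatching-≗ (sym ∘ outer≗) (isNCMatchingᵇ⇒IsNCMatching r _ (proj₁ (to T-∧ tOm)))

isNCMatchingWithᵇ-firstArc : ∀ p r k u z v → IsTuple (suc (p + suc r)) p u → IsTuple (suc (p + suc r)) r v →
  isNCMatchingWithᵇ (suc (p + suc r)) (suc k) (suc p ∷ u ++ z ∷ v) ≡ innerOkᵇ p u ∧ ((z ≡ᵇ 0) ∧ outerOkᵇ p r k v)
isNCMatchingWithᵇ-firstArc p r k u z v (len-u , _) (len-v , v<M) =
  trans (cong (λ N → isNCMatchingWithᵇ N (suc k) (suc p ∷ u ++ z ∷ v)) (cong suc (+-suc p r)))
        (T-⇔⇒≡ (cut-firstArc p r k u z v len-u len-v v<M) (glue-firstArc p r k u z v len-u len-v v<M))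

ncMatchingCount-fixedInner : ∀ p r k u → IsTuple (suc (p + suc r)) p u →
  sumTuples (suc (p + suc r)) (suc r) (λ w → indicator (isNCMatchingWithᵇ (suc (p + suc r)) (suc k) (suc p ∷ u ++ w)))
    ≡ indicator (innerOkᵇ p u) * sumTuples (suc (p + suc r)) r (indicator ∘ outerOkᵇ p r k)
ncMatchingCount-fixedInner p r k u u∈ = begin
  sumBelow (λ z → sumTuples M r (λ v → F (u ++ z ∷ v))) M
    ≡⟨ sumBelow-ext M (λ z → sumTuples-cong M r (λ v v∈ → factor z v v∈)) ⟩
  sumBelow (λ z → sumTuples M r (λ v → I * (indicator (z ≡ᵇ 0) * O v))) M
    ≡⟨ sumBelow-ext M (λ z → trans (sumTuples-*ˡ M r I _) (cong (I *_) (sumTuples-*ˡ M r (indicator (z ≡ᵇ 0)) O))) ⟩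
  I * (1 * X) + sumBelow (λ z → I * (0 * X)) (p + suc r)
    ≡⟨ cong₂ _+_ (cong (I *_) (*-identityˡ X)) (sumBelow-zero (p + suc r) (λ _ _ → *-zeroʳ I)) ⟩
  I * X + 0
    ≡⟨ +-identityʳ (I * X) ⟩
  I * X ∎
  where
  open ≡-Reasoning
  M = suc (p + suc r)
  F = λ l → indicator (isNCMatchingWithᵇ M (suc k) (suc p ∷ l))
  I = indicator (innerOkᵇ p u)
  O = λ v → indicator (outerOkᵇ p r k v)
  X = sumTuples M r O
  factor : ∀ z v → IsTuple M r v → F (u ++ z ∷ v) ≡ I * (indicator (z ≡ᵇ 0) * O v)
  factor z v v∈ = begin
    F (u ++ z ∷ v)
      ≡⟨ cong indicator (isNCMatchingWithᵇ-firstArc p r k u z v u∈ v∈) ⟩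
    indicator (innerOkᵇ p u ∧ ((z ≡ᵇ 0) ∧ outerOkᵇ p r k v))
      ≡⟨ trans (indicator-∧ (innerOkᵇ p u) _) (cong (I *_) (indicator-∧ (z ≡ᵇ 0) _)) ⟩
    I * (indicator (z ≡ᵇ 0) * O v) ∎

ncMatchingCount-firstArc : ∀ p r k →
  sumTuples (suc (p + suc r)) (p + suc r) (λ l → indicator (isNCMatchingWithᵇ (suc (p + suc r)) (suc k) (suc p ∷ l)))
    ≡ ncMatchingTotal p * ncMatchingCount r k
ncMatchingCount-firstArc p r k = begin
  sumTuples M (p + suc r) F
    ≡⟨ sumTuples-++ M p (suc r) F ⟩
  sumTuples M p (λ u → sumTuples M (suc r) (F ∘ (u ++_)))
    ≡⟨ sumTuples-cong M p (λ u u∈ → trans (ncMatchingCount-fixedInner p r k u u∈) (*-comm (I u) X)) ⟩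
  sumTuples M p (λ u → X * I u)
    ≡⟨ sumTuples-*ˡ M p X I ⟩
  X * sumTuples M p I
    ≡⟨ *-comm X (sumTuples M p I) ⟩
  sumTuples M p I * X
    ≡⟨ cong₂ _*_ innerTotal outerCount ⟩
  ncMatchingTotal p * ncMatchingCount r k ∎
  where
  open ≡-Reasoning
  M = suc (p + suc r)
  F = λ l → indicator (isNCMatchingWithᵇ M (suc k) (suc p ∷ l))
  I = λ u → indicator (innerOkᵇ p u)
  X = sumTuples M r (indicator ∘ outerOkᵇ p r k)
  innerTotal : sumTuples M p I ≡ ncMatchingTotal p
  innerTotal = trans (sumTuples-cong M p (λ u _ → indicator-∧ (inRangeᵇ 1 p u) _))
                     (sumTuples-shift M 1 p p (λ l → indicator (isNCMatchingᵇ p (nth l))) (s≤s (m≤m+n p (suc r))))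
  outerCount : X ≡ ncMatchingCount r k
  outerCount = trans (sumTuples-cong M r (λ v _ → indicator-∧ (inRangeᵇ (2 + p) r v) _))
                     (sumTuples-shift M (2 + p) r r (indicator ∘ isNCMatchingWithᵇ r k) (≤-reflexive (cong suc (sym (+-suc p r)))))

-- The first term (partner of position 0 equal to 0) vanishes by computation: such a g has a fixed point.
ncMatchingCount-suc : ∀ N k → ncMatchingCount (suc N) (suc k) ≡ sumBelow (λ p → ncMatchingTotal p * ncMatchingCount (N ∸ suc p) k) N
ncMatchingCount-suc N k = cong₂ _+_ (sumTuples-zero (suc N) N (λ _ → refl)) (sumBelow-cong N firstArc)
  where
  firstArc : ∀ p → p < N →
    sumTuples (suc N) N (λ l → indicator (isNCMatchingWithᵇ (suc N) (suc k) (suc p ∷ l)))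
      ≡ ncMatchingTotal p * ncMatchingCount (N ∸ suc p) k
  firstArc p p<N = subst (λ N′ → sumTuples (suc N′) N′ (λ l → indicator (isNCMatchingWithᵇ (suc N′) (suc k) (suc p ∷ l)))
                                   ≡ ncMatchingTotal p * ncMatchingCount (N ∸ suc p) k)
                         (trans (+-suc p (N ∸ suc p)) (m+[n∸m]≡n p<N))
                         (ncMatchingCount-firstArc p (N ∸ suc p) k)

ncMatchingCount-zero : ∀ N → ncMatchingCount (suc N) 0 ≡ 0
ncMatchingCount-zero N = sumTuples-zero (suc N) (suc N) (λ l → ¬T⇒indicator≡0 λ t →
  let (isMatching , noneExposed) = to T-∧ t in
  firstExposed (nth l) (isNCMatchingᵇ⇒IsNCMatching (suc N) (nth l) isMatching) (≡ᵇ⇒≡ _ 0 noneExposed))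
  where
  firstExposed : ∀ g → IsNCMatching (suc N) g → exposedCount (suc N) g ≢ 0
  firstExposed g m none = 1+n≢0 (trans (cong (_+ sumBelow (indicator ∘ isExposedᵇ (suc N) g ∘ suc) N) (sym exposed0)) none)
    where
    exposed0 : indicator (isExposedᵇ (suc N) g 0) ≡ 1
    exposed0 = T⇒indicator≡1 (isExposedᵇ⇐ (suc N) g 0 (n≢0⇒n>0 (IsNCMatching.fixedPointFree m 0 z<s)) λ { (c , _ , () , _) })

sumBelow-indicator≤ : ∀ (f : ℕ → Bool) N → sumBelow (indicator ∘ f) N ≤ N
sumBelow-indicator≤ f zero    = z≤n
sumBelow-indicator≤ f (suc N) = +-mono-≤ (indicator≤1 (f 0)) (sumBelow-indicator≤ (f ∘ suc) N)
  where
  indicator≤1 : ∀ b → indicator b ≤ 1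
  indicator≤1 true  = ≤-refl
  indicator≤1 false = z≤n

sumBelow-indicator-≡ᵇ : ∀ x B → x < B → sumBelow (λ k → indicator (x ≡ᵇ k)) B ≡ 1
sumBelow-indicator-≡ᵇ zero    (suc B) _         = cong suc (sumBelow-zero B (λ _ _ → refl))
sumBelow-indicator-≡ᵇ (suc x) (suc B) (s<s x<B) = sumBelow-indicator-≡ᵇ x B x<B

indicator≡sumBelow-indicator-≡ᵇ : ∀ b x B → x < B → indicator b ≡ sumBelow (λ k → indicator (b ∧ (x ≡ᵇ k))) B
indicator≡sumBelow-indicator-≡ᵇ true  x B x<B = sym (sumBelow-indicator-≡ᵇ x B x<B)
indicator≡sumBelow-indicator-≡ᵇ false x B _   = sym (sumBelow-zero B (λ _ _ → refl))

ncMatchingTotal≡sumBelow-ncMatchingCount : ∀ N → ncMatchingTotal N ≡ sumBelow (ncMatchingCount N) (suc N)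
ncMatchingTotal≡sumBelow-ncMatchingCount N =
  trans (sumTuples-cong N N (λ l _ → indicator≡sumBelow-indicator-≡ᵇ (isNCMatchingᵇ N (nth l)) (exposedCount N (nth l)) (suc N)
                                        (s≤s (sumBelow-indicator≤ (isExposedᵇ N (nth l)) N))))
        (sumTuples-sumBelow N N (suc N) (λ l k → indicator (isNCMatchingWithᵇ N k l)))

-- Matchings of an even and of an odd number of positions

EvenCount : ℕ → Set
EvenCount n = ∀ k → ncMatchingCount (n + n) k ≡ catalanPower n k

OddCount : ℕ → Set
OddCount n = ∀ k → ncMatchingCount (suc (n + n)) k ≡ 0

evenTotal : ∀ n → EvenCount n → ncMatchingTotal (n + n) ≡ catalan n
evenTotal n even = begin
  ncMatchingTotal (n + n)                 ≡⟨ ncMatchingTotal≡sumBelow-ncMatchingCount (n + n) ⟩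
  sumBelow (ncMatchingCount (n + n)) (suc (n + n)) ≡⟨ sumBelow-ext (suc (n + n)) even ⟩
  sumBelow (catalanPower n) (suc (n + n)) ≡⟨ sumBelow-catalanPower n (suc (n + n)) (s≤s (m≤m+n n n)) ⟩
  catalan n                               ∎
  where open ≡-Reasoning

oddTotal : ∀ n → OddCount n → ncMatchingTotal (suc (n + n)) ≡ 0
oddTotal n odd = trans (ncMatchingTotal≡sumBelow-ncMatchingCount (suc (n + n))) (sumBelow-zero (suc (suc (n + n))) (λ k _ → odd k))

[m+m]∸[n+n]≡[m∸n]+[m∸n] : ∀ m n → n ≤ m → (m + m) ∸ (n + n) ≡ (m ∸ n) + (m ∸ n)
[m+m]∸[n+n]≡[m∸n]+[m∸n] m       zero    _         = refl
[m+m]∸[n+n]≡[m∸n]+[m∸n] (suc m) (suc n) (s≤s n≤m) rewrite +-suc m m | +-suc n n = [m+m]∸[n+n]≡[m∸n]+[m∸n] m n n≤m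

evenCount-suc : ∀ n → (∀ m → m ≤ n → EvenCount m × OddCount m) → EvenCount (suc n)
evenCount-suc n ih zero    = ncMatchingCount-zero (n + suc n)
evenCount-suc n ih (suc k) = begin
  ncMatchingCount (suc (n + suc n)) (suc k)
    ≡⟨ ncMatchingCount-suc (n + suc n) k ⟩
  sumBelow f (n + suc n)
    ≡⟨ cong (sumBelow f) (+-suc n n) ⟩
  sumBelow f (suc (n + n))
    ≡⟨ sumBelow-sucʳ f (n + n) ⟩
  sumBelow f (n + n) + f (n + n)
    ≡⟨ cong (_+ f (n + n)) (sumBelow-even+odd f n) ⟩
  sumBelow (λ j → f (j + j) + f (suc (j + j))) n + f (n + n)
    ≡⟨ cong₂ _+_ (sumBelow-cong n (λ j j<n → trans (cong₂ _+_ (even j (<⇒≤ j<n)) (odd j j<n)) (+-identityʳ _)))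
                 (even n ≤-refl) ⟩
  sumBelow (λ i → catalan i * catalanPower (n ∸ i) k) n + catalan n * catalanPower (n ∸ n) k
    ≡⟨ sym (sumBelow-sucʳ (λ i → catalan i * catalanPower (n ∸ i) k) n) ⟩
  catalanPower (suc n) (suc k) ∎
  where
  open ≡-Reasoning
  f = λ p → ncMatchingTotal p * ncMatchingCount ((n + suc n) ∸ suc p) k
  even : ∀ j → j ≤ n → f (j + j) ≡ catalan j * catalanPower (n ∸ j) k
  even j j≤n = cong₂ _*_ (evenTotal j (proj₁ (ih j j≤n)))
    (trans (cong (λ x → ncMatchingCount x k) (trans (cong (_∸ suc (j + j)) (+-suc n n)) ([m+m]∸[n+n]≡[m∸n]+[m∸n] n j j≤n)))
           (proj₁ (ih (n ∸ j) (m∸n≤m n j)) k))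
  odd : ∀ j → j < n → f (suc (j + j)) ≡ 0
  odd j j<n = cong (_* ncMatchingCount ((n + suc n) ∸ suc (suc (j + j))) k) (oddTotal j (proj₂ (ih j (<⇒≤ j<n))))

oddCount-suc : ∀ n → (∀ m → m ≤ n → EvenCount m × OddCount m) → OddCount (suc n)
oddCount-suc n ih zero    = ncMatchingCount-zero (suc (n + suc n))
oddCount-suc n ih (suc k) = begin
  ncMatchingCount (suc (suc (n + suc n))) (suc k)
    ≡⟨ ncMatchingCount-suc (suc (n + suc n)) k ⟩
  sumBelow f (suc n + suc n)
    ≡⟨ sumBelow-even+odd f (suc n) ⟩
  sumBelow (λ j → f (j + j) + f (suc (j + j))) (suc n)
    ≡⟨ sumBelow-zero (suc n) (λ j j<1+n → cong₂ _+_ (even j (≤-pred j<1+n)) (odd j (≤-pred j<1+n))) ⟩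
  0 ∎
  where
  open ≡-Reasoning
  f = λ p → ncMatchingTotal p * ncMatchingCount (suc (n + suc n) ∸ suc p) k
  even : ∀ j → j ≤ n → f (j + j) ≡ 0
  even j j≤n = trans (cong (ncMatchingTotal (j + j) *_)
      (trans (cong (λ x → ncMatchingCount x k) (trans (cong (_∸ (j + j)) (+-suc n n))
                (trans (+-∸-assoc 1 (+-mono-≤ j≤n j≤n)) (cong suc ([m+m]∸[n+n]≡[m∸n]+[m∸n] n j j≤n)))))
             (proj₂ (ih (n ∸ j) (m∸n≤m n j)) k)))
      (*-zeroʳ (ncMatchingTotal (j + j)))
  odd : ∀ j → j ≤ n → f (suc (j + j)) ≡ 0
  odd j j≤n = cong (_* ncMatchingCount (suc (n + suc n) ∸ suc (suc (j + j))) k) (oddTotal j (proj₂ (ih j j≤n)))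

evenOddCount : ∀ n → EvenCount n × OddCount n
evenOddCount = <-rec (λ n → EvenCount n × OddCount n) step
  where
  step : ∀ n → (∀ {m} → m < n → EvenCount m × OddCount m) → EvenCount n × OddCount n
  step zero    _  = (λ { zero → refl ; (suc k) → refl }) , (λ { zero → ncMatchingCount-zero 0 ; (suc k) → ncMatchingCount-suc 0 k })
  step (suc n) ih = evenCount-suc n ih′ , oddCount-suc n ih′
    where
    ih′ : ∀ m → m ≤ n → EvenCount m × OddCount m
    ih′ m m≤n = ih (s≤s m≤n)

lemma5p13 : (n k : ℕ) → 1 ≤ n → 1 ≤ k → k ≤ n → chi n k ≡ catalanSumQ n k
lemma5p13 n k _ 1≤k k≤n = begin
  chi n k                   ≡⟨ chi≡ncMatchingCount n k ⟩
  ncMatchingCount (n + n) k ≡⟨ proj₁ (evenOddCount n) k ⟩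
  catalanPower n k          ≡⟨ sym (catalanSumQ≡catalanPower n k 1≤k k≤n) ⟩
  catalanSumQ n k           ∎
  where open ≡-Reasoning
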